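{- There are absolute constants $a,b>0$ such that the following holds. Let $d$ be a positive integer and $\epsilon\in(0,1/2)$. Let $k\leq l<d/3$ be integers with $k\cdot l<d\ln(1/(3\epsilon))/3$. Let $\lambda$ be the uniform distribution over subsets $x\subseteq[d]$ of size $k$, and $\rho$ the uniform distribution over subsets $y\subseteq[d]$ of size $l$. For any deterministic protocol $\pi$ for set disjointness over $\lambda\times\rho$ with $\epsilon$ type II error, either Alice sends at least $a k$ bits or Bob sends at least $b l$ bits.
   Context: Set disjointness: $f(x,y)=1$ iff $x\cap y=\emptyset$. A deterministic two-party protocol $\pi$ (Alice holds $x$, Bob holds $y$) for $f$ over $\lambda\times\rho$ has $\epsilon$ error if $\Pr_{x\sim\lambda,y\sim\rho}[\pi(x,y)\neq f(x,y)]\leq\epsilon$; it has type II error if it can be incorrect only when $f(x,y)=1$. The paper states the conclusion as "either $a=\Omega(k)$ or $b=\Omega(l)$" where $a,b$ are the numbers of bits sent by Alice and Bob.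
   Formalization: The error parameter $\epsilon$ ranges only over the rationals in (0,1/2). -}

module Defs where

open import Data.Bool using (Bool; true; false; if_then_else_)
import Data.Bool as B
open import Data.Nat as ℕ using (ℕ; zero; suc; _≡ᵇ_)
open import Data.Integer using (+_)
open import Data.Rational using (ℚ; _+_; _*_; _/_; 1ℚ; _≤_; _<_)
open import Data.List using (List; []; _∷_; _++_; map; filter; length; concatMap)
open import Data.Vec using (Vec; []; _∷_)
open import Data.Vec.Properties using (≡-dec)
open import Data.Fin.Subset using (Subset; _∩_; ⊥; ∣_∣)
open import Data.Product using (Σ; _×_; _,_)
open import Relation.Nullary using (does)
open import Relation.Binary.PropositionalEquality using (_≡_)

-- Set disjointness  f(x,y) = 1  iff  x ∩ y = ∅   (true = 1, false = 0)

disj : ∀ {d} → Subset d → Subset d → Bool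
disj x y = does (≡-dec B._≟_ (x ∩ y) ⊥)

allSubsets : ∀ n → List (Subset n)
allSubsets zero    = [] ∷ []
allSubsets (suc n) = map (true ∷_) (allSubsets n) ++ map (false ∷_) (allSubsets n)

subsetsOfSize : ∀ d → ℕ → List (Subset d)
subsetsOfSize d k = filter (λ x → ℕ._≟_ ∣ x ∣ k) (allSubsets d)

data Protocol (X Y : Set) : Set where
  leaf  : Bool → Protocol X Y
  alice : (X → Bool) → (onTrue onFalse : Protocol X Y) → Protocol X Y
  bob   : (Y → Bool) → (onTrue onFalse : Protocol X Y) → Protocol X Y

module _ {X Y : Set} where

  run : Protocol X Y → X → Y → Bool
  run (leaf o)      x y = o
  run (alice m t f) x y = if m x then run t x y else run f x y
  run (bob m t f)   x y = if m y then run t x y else run f x y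

  aliceBits : Protocol X Y → X → Y → ℕ
  aliceBits (leaf o)      x y = 0
  aliceBits (alice m t f) x y = suc (if m x then aliceBits t x y else aliceBits f x y)
  aliceBits (bob m t f)   x y = if m y then aliceBits t x y else aliceBits f x y

  bobBits : Protocol X Y → X → Y → ℕ
  bobBits (leaf o)      x y = 0
  bobBits (alice m t f) x y = if m x then bobBits t x y else bobBits f x y
  bobBits (bob m t f)   x y = suc (if m y then bobBits t x y else bobBits f x y)

module _ {d : ℕ} where

  _≠ᵇ_ : Bool → Bool → Bool
  a ≠ᵇ b = B.not (does (a B.≟ b))

  errorCount : Protocol (Subset d) (Subset d) → ℕ → ℕ → ℕ
  errorCount π k l =
    length (concatMap (λ x → filter (λ y → B.T? (run π x y ≠ᵇ disj x y))
                                    (subsetsOfSize d l))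
                      (subsetsOfSize d k))

  -- Pr_{x∼λ, y∼ρ}[π(x,y) ≠ f(x,y)] ≤ ε,  written without division:
  -- #errors ≤ ε · |supp λ| · |supp ρ|
  HasError≤ : Protocol (Subset d) (Subset d) → ℕ → ℕ → ℚ → Set
  HasError≤ π k l ε =
    (+ errorCount π k l / 1) ≤
      ε * (+ length (subsetsOfSize d k) / 1) * (+ length (subsetsOfSize d l) / 1)

  -- type II error: π can be wrong only when f(x,y) = 1, i.e. on every pair
  -- of the support with f(x,y) = 0 (intersecting sets) π answers 0
  TypeII : Protocol (Subset d) (Subset d) → ℕ → ℕ → Set
  TypeII π k l =
    ∀ x y → ∣ x ∣ ≡ k → ∣ y ∣ ≡ l → disj x y ≡ false → run π x y ≡ false

expTerm : ℚ → ℕ → ℚ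
expTerm t zero    = 1ℚ
expTerm t (suc n) = expTerm t n * t * (+ 1 / suc n)

expPartial : ℚ → ℕ → ℚ
expPartial t zero    = expTerm t 0
expPartial t (suc N) = expPartial t N + expTerm t (suc N)

-- For t ≥ 0, exp t = sup_N expPartial t N, so
--   exp t < 1 / (3ε)   iff   ∃ q, 3ε·q < 1  and  ∀ N, expPartial t N ≤ q.
ExpLtInv3ε : ℚ → ℚ → Set
ExpLtInv3ε t ε = Σ ℚ λ q → ((+ 3 / 1) * ε * q < 1ℚ) × (∀ N → expPartial t N ≤ q)

-- Let X and Y be the k- and l-subsets of [d], and suppose that on every pair of X × Y
-- Alice sends at most a and Bob at most b bits, where 24a ≤ k and 24b ≤ l. A type II
-- protocol accepts only disjoint pairs, and a rectangle P × Q of disjoint pairs is small: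
-- if the union U of the sets in P has at most 4(d − l)/5 points, then P consists of
-- k-subsets of U and 3·2^a·|P| ≤ C(d − l, k); otherwise every y ∈ Q avoids U and
-- 3·2^b·|Q| ≤ C(d − k, l). Induction over the protocol tree (each bit of Alice doubles the
-- first bound, each bit of Bob the second) shows that π accepts at most 2/3 of the D
-- disjoint pairs. On the other hand |X| = C(d, k) ≤ C(d − l, k)·(1 + 3l/d)^k, which is
-- less than C(d − l, k)/(3ε), so fewer than D/3 pairs are errors, while every disjoint pair
-- is accepted or an error. For k ≤ 6 Alice sends nothing, so π answers on (x, y) as on
-- (x₀, y) for some x₀ meeting y, i.e. it rejects, and all D pairs are errors.

module Submission where

open import Defs
open import Data.Nat as ℕ using (ℕ; NonZero)
open import Data.Fin.Subset using (Subset; ∣_∣)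
open import Data.Product using (Σ; _×_; _,_)
open import Data.Sum using (_⊎_)
open import Relation.Binary.PropositionalEquality using (_≡_)

module Lists where

  open import Algebra.Properties.CommutativeSemigroup using (interchange)
  open import Data.Bool.Base using (Bool; true; false; not; _∧_; if_then_else_)
  open import Data.List.Base using (List; []; _∷_; _++_; map; filter; length; concatMap)
  open import Data.List.Properties using (length-++)
  open import Data.List.Membership.Propositional using (_∈_; find; lose)
  open import Data.List.Relation.Unary.Any using (here; there; any?)
  open import Data.Nat.Base
  open import Data.Nat.Properties
  open import Data.Product using (∃; _×_; _,_)
  open import Data.Sum using (_⊎_; inj₁; inj₂)
  open import Relation.Nullary using (Dec; yes; no; does; ¬_)
  open import Relation.Binary.PropositionalEquality

  private variable
    A B : Set

  ∑ : List A → (A → ℕ) → ℕ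
  ∑ []       f = 0
  ∑ (x ∷ xs) f = f x + ∑ xs f

  𝟙 : Bool → ℕ
  𝟙 true  = 1
  𝟙 false = 0

  count : (A → Bool) → List A → ℕ
  count p xs = ∑ xs (λ x → 𝟙 (p x))

  ∑-cong : ∀ xs {f g : A → ℕ} → (∀ x → x ∈ xs → f x ≡ g x) → ∑ xs f ≡ ∑ xs g
  ∑-cong []       f≡g = refl
  ∑-cong (x ∷ xs) f≡g = cong₂ _+_ (f≡g x (here refl)) (∑-cong xs (λ y y∈xs → f≡g y (there y∈xs)))

  ∑-mono-≤ : ∀ xs {f g : A → ℕ} → (∀ x → x ∈ xs → f x ≤ g x) → ∑ xs f ≤ ∑ xs g
  ∑-mono-≤ []       f≤g = z≤n
  ∑-mono-≤ (x ∷ xs) f≤g = +-mono-≤ (f≤g x (here refl)) (∑-mono-≤ xs (λ y y∈xs → f≤g y (there y∈xs)))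

  ∑-const : ∀ (xs : List A) c → ∑ xs (λ _ → c) ≡ length xs * c
  ∑-const []       c = refl
  ∑-const (x ∷ xs) c = cong (c +_) (∑-const xs c)

  ∑-≡0 : ∀ xs {f : A → ℕ} → (∀ x → x ∈ xs → f x ≡ 0) → ∑ xs f ≡ 0
  ∑-≡0 xs f≡0 = trans (∑-cong xs f≡0) (trans (∑-const xs 0) (*-zeroʳ (length xs)))

  ∑-distrib-+ : ∀ xs (f g : A → ℕ) → ∑ xs (λ x → f x + g x) ≡ ∑ xs f + ∑ xs g
  ∑-distrib-+ []       f g = refl
  ∑-distrib-+ (x ∷ xs) f g = trans (cong (f x + g x +_) (∑-distrib-+ xs f g))
                                   (interchange +-commutativeSemigroup (f x) (g x) (∑ xs f) (∑ xs g))

  *-distribˡ-∑ : ∀ c xs (f : A → ℕ) → ∑ xs (λ x → c * f x) ≡ c * ∑ xs f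
  *-distribˡ-∑ c []       f = sym (*-zeroʳ c)
  *-distribˡ-∑ c (x ∷ xs) f = trans (cong (c * f x +_) (*-distribˡ-∑ c xs f)) (sym (*-distribˡ-+ c (f x) (∑ xs f)))

  *-distribʳ-∑ : ∀ c xs (f : A → ℕ) → ∑ xs (λ x → f x * c) ≡ ∑ xs f * c
  *-distribʳ-∑ c []       f = refl
  *-distribʳ-∑ c (x ∷ xs) f = trans (cong (f x * c +_) (*-distribʳ-∑ c xs f)) (sym (*-distribʳ-+ c (f x) (∑ xs f)))

  ∑-++ : ∀ xs ys (f : A → ℕ) → ∑ (xs ++ ys) f ≡ ∑ xs f + ∑ ys f
  ∑-++ []       ys f = refl
  ∑-++ (x ∷ xs) ys f = trans (cong (f x +_) (∑-++ xs ys f)) (sym (+-assoc (f x) (∑ xs f) (∑ ys f)))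

  ∑-map : ∀ (g : B → A) xs (f : A → ℕ) → ∑ (map g xs) f ≡ ∑ xs (λ x → f (g x))
  ∑-map g []       f = refl
  ∑-map g (x ∷ xs) f = cong (f (g x) +_) (∑-map g xs f)

  ∑-comm : ∀ (xs : List A) (ys : List B) (f : A → B → ℕ) →
           ∑ xs (λ x → ∑ ys (f x)) ≡ ∑ ys (λ y → ∑ xs (λ x → f x y))
  ∑-comm []       ys f = sym (∑-≡0 ys (λ _ _ → refl))
  ∑-comm (x ∷ xs) ys f = trans (cong (∑ ys (f x) +_) (∑-comm xs ys f))
                               (sym (∑-distrib-+ ys (f x) (λ y → ∑ xs (λ x′ → f x′ y))))

  ∑-filter : ∀ {P : A → Set} (P? : ∀ x → Dec (P x)) xs (f : A → ℕ) →
             ∑ (filter P? xs) f ≡ ∑ xs (λ x → if does (P? x) then f x else 0)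
  ∑-filter P? []       f = refl
  ∑-filter P? (x ∷ xs) f with does (P? x)
  ... | true  = cong (f x +_) (∑-filter P? xs f)
  ... | false = ∑-filter P? xs f

  length-filter : ∀ {P : A → Set} (P? : ∀ x → Dec (P x)) xs → length (filter P? xs) ≡ count (λ x → does (P? x)) xs
  length-filter P? []       = refl
  length-filter P? (x ∷ xs) with does (P? x)
  ... | true  = cong suc (length-filter P? xs)
  ... | false = length-filter P? xs

  length-concatMap : ∀ (g : A → List B) xs → length (concatMap g xs) ≡ ∑ xs (λ x → length (g x))
  length-concatMap g []       = refl
  length-concatMap g (x ∷ xs) = trans (length-++ (g x)) (cong (length (g x) +_) (length-concatMap g xs))

  count-split : ∀ (p m : A → Bool) xs → count p xs ≡ count (λ x → p x ∧ m x) xs + count (λ x → p x ∧ not (m x)) xs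
  count-split p m xs = trans (∑-cong xs (λ x _ → 𝟙-split (p x) (m x))) (∑-distrib-+ xs _ _)
    where
    𝟙-split : ∀ a b → 𝟙 a ≡ 𝟙 (a ∧ b) + 𝟙 (a ∧ not b)
    𝟙-split true  true  = refl
    𝟙-split true  false = refl
    𝟙-split false b     = refl

  count-mono : ∀ xs {p q : A → Bool} → (∀ x → x ∈ xs → p x ≡ true → q x ≡ true) → count p xs ≤ count q xs
  count-mono xs {p} {q} p⇒q = ∑-mono-≤ xs 𝟙-mono
    where
    𝟙-mono : ∀ x → x ∈ xs → 𝟙 (p x) ≤ 𝟙 (q x)
    𝟙-mono x x∈xs with p x in px
    ... | false = z≤n
    ... | true  = ≤-reflexive (cong 𝟙 (sym (p⇒q x x∈xs px)))

  count-true : ∀ (xs : List A) → count (λ _ → true) xs ≡ length xs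
  count-true xs = trans (∑-const xs 1) (*-identityʳ (length xs))

  count<length⇒∃false : ∀ (p : A → Bool) xs → count p xs < length xs → ∃ λ x → x ∈ xs × p x ≡ false
  count<length⇒∃false p (x ∷ xs) count<length with p x in px
  ... | false = x , here refl , px
  ... | true  = let y , y∈xs , py = count<length⇒∃false p xs (s≤s⁻¹ count<length) in y , there y∈xs , py

  search-pairs : ∀ {R : A → B → Set} (xs : List A) (ys : List B) → (∀ x y → Dec (R x y)) →
                 (∃ λ x → ∃ λ y → x ∈ xs × y ∈ ys × R x y) ⊎ (∀ x y → x ∈ xs → y ∈ ys → ¬ R x y)
  search-pairs xs ys R? with any? (λ x → any? (R? x) ys) xs
  ... | yes found = let x , x∈xs , found-y = find found ; y , y∈ys , r = find found-y in inj₁ (x , y , x∈xs , y∈ys , r)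
  ... | no  none  = inj₂ (λ x y x∈xs y∈ys r → none (lose x∈xs (lose y∈ys r)))

module Binomials where

  open import Data.Nat.Base
  open import Data.Nat.Properties
  open import Data.Nat.Combinatorics using (_C_; nC1≡n; nCk+nC[k+1]≡[n+1]C[k+1])
  open import Data.Nat.Tactic.RingSolver using (solve-∀)
  open import Relation.Binary.PropositionalEquality

  C-suc-suc : ∀ n k → suc n C suc k ≡ n C k + n C suc k
  C-suc-suc n k = sym (nCk+nC[k+1]≡[n+1]C[k+1] n k)

  C-absorb : ∀ n k → suc k * (suc n C suc k) ≡ suc n * (n C k)
  C-absorb zero    zero    = refl
  C-absorb zero    (suc k) = *-zeroʳ (suc (suc k))
  C-absorb (suc n) zero    = trans (*-identityˡ _) (trans (nC1≡n (suc (suc n))) (sym (*-identityʳ _)))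
  C-absorb (suc n) (suc k) = begin
    suc (suc k) * (suc (suc n) C suc (suc k))       ≡⟨ cong (suc (suc k) *_) (C-suc-suc (suc n) (suc k)) ⟩
    suc (suc k) * (a + b)                            ≡⟨ distribute a b k ⟩
    a + (suc k * a + suc (suc k) * b)                ≡⟨ cong (λ z → a + z) (cong₂ _+_ (C-absorb n k) (C-absorb n (suc k))) ⟩
    a + (suc n * (n C k) + suc n * (n C suc k))      ≡⟨ cong (a +_) (sym (*-distribˡ-+ (suc n) (n C k) (n C suc k))) ⟩
    a + suc n * (n C k + n C suc k)                  ≡⟨ cong (λ z → a + suc n * z) (sym (C-suc-suc n k)) ⟩
    suc (suc n) * a                                  ∎
    where
    open ≡-Reasoning
    a = suc n C suc k
    b = suc n C suc (suc k)
    distribute : ∀ p q j → suc (suc j) * (p + q) ≡ p + (suc j * p + suc (suc j) * q)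
    distribute = solve-∀

  C-monoˡ-≤ : ∀ k {m n} → m ≤ n → m C k ≤ n C k
  C-monoˡ-≤ zero    _         = ≤-refl
  C-monoˡ-≤ (suc k) z≤n       = z≤n
  C-monoˡ-≤ (suc k) {suc m} {suc n} (s≤s m≤n) =
    subst₂ _≤_ (sym (C-suc-suc m k)) (sym (C-suc-suc n k)) (+-mono-≤ (C-monoˡ-≤ k m≤n) (C-monoˡ-≤ (suc k) m≤n))

  C-pos : ∀ {n k} → k ≤ n → 0 < n C k
  C-pos {n}     {zero}  _         = z<s
  C-pos {suc n} {suc k} (s≤s k≤n) = subst (0 <_) (sym (C-suc-suc n k)) (≤-trans (C-pos k≤n) (m≤m+n (n C k) (n C suc k)))

  C-monoˡ-< : ∀ {n m k} → 0 < k → k ≤ m → m < n → (n ∸ m) C k < n C k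
  C-monoˡ-< {suc n} {suc m} {suc k} _ (s≤s k≤m) (s≤s m<n) = begin-strict
    (n ∸ m) C suc k    ≤⟨ C-monoˡ-≤ (suc k) (m∸n≤m n m) ⟩
    n C suc k          <⟨ m<n+m (n C suc k) (C-pos (≤-trans k≤m (<⇒≤ m<n))) ⟩
    n C k + n C suc k  ≡⟨ C-suc-suc n k ⟨
    suc n C suc k      ∎
    where open ≤-Reasoning

  -- (u C k) / (n C k) is the product of the ratios (u − i) / (n − i) over i < k.
  C-ratio : ∀ k {u n} p q → k ≤ n → (∀ i → i < k → q * (u ∸ i) ≤ p * (n ∸ i)) →
            (u C k) * q ^ k ≤ (n C k) * p ^ k
  C-ratio zero    p q _ _ = ≤-refl
  C-ratio (suc k) {zero}  p q _ _ = z≤n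
  C-ratio (suc k) {suc u} {suc n} p q (s≤s k≤n) step = *-cancelˡ-≤ (suc k) (begin
    suc k * ((suc u C suc k) * q ^ suc k)  ≡⟨ absorbed u q ⟩
    (q * suc u) * ((u C k) * q ^ k)        ≤⟨ *-mono-≤ (step 0 z<s) (C-ratio k p q k≤n (λ i i<k → step (suc i) (s≤s i<k))) ⟩
    (p * suc n) * ((n C k) * p ^ k)        ≡⟨ absorbed n p ⟨
    suc k * ((suc n C suc k) * p ^ suc k)  ∎)
    where
    open ≤-Reasoning
    regroup : ∀ a b c d → (a * b) * (c * d) ≡ (c * a) * (b * d)
    regroup = solve-∀
    absorbed : ∀ m r → suc k * ((suc m C suc k) * r ^ suc k) ≡ (r * suc m) * ((m C k) * r ^ k)
    absorbed m r = begin-equality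
      suc k * ((suc m C suc k) * r ^ suc k)  ≡⟨ *-assoc (suc k) (suc m C suc k) (r ^ suc k) ⟨
      (suc k * (suc m C suc k)) * (r * r ^ k)  ≡⟨ cong (_* (r * r ^ k)) (C-absorb m k) ⟩
      (suc m * (m C k)) * (r * r ^ k)  ≡⟨ regroup (suc m) (m C k) r (r ^ k) ⟩
      (r * suc m) * ((m C k) * r ^ k)  ∎

  C-ratio-≤ : ∀ k {u n} α β → k ≤ n → α * u ≤ β * n → β ≤ α → (u C k) * α ^ k ≤ (n C k) * β ^ k
  C-ratio-≤ k {u} {n} α β k≤n αu≤βn β≤α = C-ratio k β α k≤n step
    where
    open ≤-Reasoning
    step : ∀ i → i < k → α * (u ∸ i) ≤ β * (n ∸ i)
    step i _ = begin
      α * (u ∸ i)      ≡⟨ *-distribˡ-∸ α u i ⟩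
      α * u ∸ α * i    ≤⟨ ∸-mono αu≤βn (*-monoˡ-≤ i β≤α) ⟩
      β * n ∸ β * i    ≡⟨ *-distribˡ-∸ β n i ⟨
      β * (n ∸ i)      ∎

module Subsets where

  open import Defs using (disj; allSubsets; subsetsOfSize)
  open Lists
  open Binomials using (C-suc-suc)
  open import Data.Bool.Base using (true; false; _∧_; if_then_else_)
  open import Data.Bool.Properties using (∧-zeroʳ)
  import Data.Bool.Properties as Bool
  open import Data.Fin.Subset using (Subset; _∩_; ∁; ⊥; ⊤; ⋃; ∣_∣; _⊆_; outside; inside)
    renaming (_∈_ to _∈ₛ_)
  open import Data.Fin.Subset.Properties
    using (_⊆?_; _∈?_; ⊆⊤; ∣⊤∣≡n; ∣∁p∣≡n∸∣p∣; ∩-comm; Empty-unique; ∉⊥; x∈p∩q⁺; x∈p∩q⁻;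
           x∈∁p⇒x∉p; x∉p⇒x∈∁p; p⊆p∪q; q⊆p∪q; x∈p∪q⁻; ⊆-trans)
  open import Data.List.Base using (List; []; _∷_; _++_; map; length)
  open import Data.List.Membership.Propositional using (_∈_)
  open import Data.List.Membership.Propositional.Properties using (∈-filter⁻)
  open import Data.List.Relation.Unary.Any using (here; there)
  open import Data.Nat.Base using (ℕ; zero; suc; _+_; _*_; _∸_; _≡ᵇ_)
  open import Data.Nat.Properties using (*-identityʳ)
  import Data.Nat.Properties as ℕ
  open import Data.Nat.Combinatorics using (_C_)
  open import Data.Product using (_,_; proj₂)
  open import Data.Sum using ([_,_])
  open import Data.Vec.Base using ([]; _∷_)
  open import Data.Vec.Properties using (≡-dec)
  open import Function using (_⇔_; mk⇔; Equivalence)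
  open import Relation.Nullary using (Dec; yes; no; does; contradiction)
  open import Relation.Nullary.Decidable using (dec-true; does-⇔)
  open import Relation.Binary.PropositionalEquality hiding ([_])

  private variable
    d : ℕ
    x y z : Subset d

  does-sound : ∀ {P : Set} (P? : Dec P) → does P? ≡ true → P
  does-sound (yes p) _ = p

  ∩≡⊥⇔⊆∁ : (x ∩ y ≡ ⊥) ⇔ (x ⊆ ∁ y)
  ∩≡⊥⇔⊆∁ {x = x} {y} = mk⇔ ⊆∁ ∩≡⊥
    where
    ⊆∁ : x ∩ y ≡ ⊥ → x ⊆ ∁ y
    ⊆∁ x∩y≡⊥ {i} i∈x with i ∈? y
    ... | yes i∈y = contradiction (subst (i ∈ₛ_) x∩y≡⊥ (x∈p∩q⁺ (i∈x , i∈y))) ∉⊥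
    ... | no  i∉y = x∉p⇒x∈∁p i∉y
    ∩≡⊥ : x ⊆ ∁ y → x ∩ y ≡ ⊥
    ∩≡⊥ x⊆∁y = Empty-unique λ (i , i∈x∩y) →
      let i∈x , i∈y = x∈p∩q⁻ x y i∈x∩y in x∈∁p⇒x∉p (x⊆∁y i∈x) i∈y

  disj≡does-⊆∁ : (x y : Subset d) → disj x y ≡ does (x ⊆? ∁ y)
  disj≡does-⊆∁ x y = does-⇔ ∩≡⊥⇔⊆∁ (≡-dec Bool._≟_ (x ∩ y) ⊥) (x ⊆? ∁ y)

  disj-comm : (x y : Subset d) → disj x y ≡ disj y x
  disj-comm x y = cong (λ z → does (≡-dec Bool._≟_ z ⊥)) (∩-comm x y)

  disj⇒⊆∁ : disj x y ≡ true → x ⊆ ∁ y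
  disj⇒⊆∁ {x = x} {y} h = does-sound (x ⊆? ∁ y) (trans (sym (disj≡does-⊆∁ x y)) h)

  ⊆∁-comm : x ⊆ ∁ y → y ⊆ ∁ x
  ⊆∁-comm {x = x} {y} h =
    Equivalence.to ∩≡⊥⇔⊆∁ (trans (∩-comm y x) (Equivalence.from ∩≡⊥⇔⊆∁ h))

  ⊆⋃ : ∀ {xs : List (Subset d)} → x ∈ xs → x ⊆ ⋃ xs
  ⊆⋃ {xs = x ∷ xs} (here refl) = p⊆p∪q (⋃ xs)
  ⊆⋃ {xs = x′ ∷ xs} (there x∈xs) = ⊆-trans (⊆⋃ x∈xs) (q⊆p∪q x′ (⋃ xs))

  ⋃-least : ∀ (xs : List (Subset d)) → (∀ x → x ∈ xs → x ⊆ z) → ⋃ xs ⊆ z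
  ⋃-least []       _   i∈⊥ = contradiction i∈⊥ ∉⊥
  ⋃-least (x ∷ xs) all⊆ i∈⋃ =
    [ all⊆ x (here refl) , ⋃-least xs (λ x′ x′∈xs → all⊆ x′ (there x′∈xs)) ] (x∈p∪q⁻ x (⋃ xs) i∈⋃)

  ∈-subsetsOfSize⁻ : ∀ {k} → x ∈ subsetsOfSize d k → ∣ x ∣ ≡ k
  ∈-subsetsOfSize⁻ {k = k} x∈ = proj₂ (∈-filter⁻ (λ x → ∣ x ∣ ℕ.≟ k) {xs = allSubsets _} x∈)

  count-⊆-allSubsets : ∀ (V : Subset d) k →
    ∑ (allSubsets d) (λ x → 𝟙 ((∣ x ∣ ≡ᵇ k) ∧ does (x ⊆? V))) ≡ ∣ V ∣ C k
  count-⊆-allSubsets []      zero    = refl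
  count-⊆-allSubsets []      (suc k) = refl
  count-⊆-allSubsets {suc d} (v ∷ V) k = begin
    ∑ (map (inside ∷_) S ++ map (outside ∷_) S) f                    ≡⟨ ∑-++ (map (inside ∷_) S) (map (outside ∷_) S) f ⟩
    ∑ (map (inside ∷_) S) f + ∑ (map (outside ∷_) S) f               ≡⟨ cong₂ _+_ (∑-map (inside ∷_) S f) (∑-map (outside ∷_) S f) ⟩
    ∑ S (λ x → f (inside ∷ x)) + ∑ S (λ x → f (outside ∷ x))         ≡⟨ split v k ⟩
    ∣ v ∷ V ∣ C k                                                    ∎
    where
    open ≡-Reasoning
    S = allSubsets d
    f : Subset (suc d) → ℕ
    f x = 𝟙 ((∣ x ∣ ≡ᵇ k) ∧ does (x ⊆? (v ∷ V)))
    g : ℕ → Subset d → ℕ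
    g k x = 𝟙 ((∣ x ∣ ≡ᵇ k) ∧ does (x ⊆? V))
    split : ∀ v k → ∑ S (λ x → 𝟙 ((suc ∣ x ∣ ≡ᵇ k) ∧ does ((inside ∷ x) ⊆? (v ∷ V)))) + ∑ S (g k)
                    ≡ ∣ v ∷ V ∣ C k
    split inside  zero    =
      trans (cong (_+ ∑ S (g zero)) (∑-≡0 S (λ _ _ → refl))) (count-⊆-allSubsets V zero)
    split inside  (suc k) =
      trans (cong₂ _+_ (count-⊆-allSubsets V k) (count-⊆-allSubsets V (suc k))) (sym (C-suc-suc ∣ V ∣ k))
    split outside k       =
      trans (cong (_+ ∑ S (g k)) (∑-≡0 S (λ x _ → cong 𝟙 (∧-zeroʳ (suc ∣ x ∣ ≡ᵇ k))))) (count-⊆-allSubsets V k)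

  count-⊆ : ∀ (V : Subset d) k → count (λ x → does (x ⊆? V)) (subsetsOfSize d k) ≡ ∣ V ∣ C k
  count-⊆ {d} V k = trans (∑-filter (λ x → ∣ x ∣ ℕ.≟ k) (allSubsets d) _)
                          (trans (∑-cong (allSubsets d) (λ x _ → if-𝟙 (∣ x ∣ ≡ᵇ k) (does (x ⊆? V)))) (count-⊆-allSubsets V k))
    where
    if-𝟙 : ∀ a b → (if a then 𝟙 b else 0) ≡ 𝟙 (a ∧ b)
    if-𝟙 true  b = refl
    if-𝟙 false b = refl

  length-subsetsOfSize : ∀ d k → length (subsetsOfSize d k) ≡ d C k
  length-subsetsOfSize d k = begin
    length X                           ≡⟨ *-identityʳ (length X) ⟨
    length X * 1                       ≡⟨ ∑-const X 1 ⟨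
    ∑ X (λ _ → 1)                      ≡⟨ ∑-cong X (λ x _ → cong 𝟙 (dec-true (x ⊆? ⊤) ⊆⊤)) ⟨
    count (λ x → does (x ⊆? ⊤)) X      ≡⟨ count-⊆ (⊤ {d}) k ⟩
    ∣ ⊤ {d} ∣ C k                      ≡⟨ cong (_C k) (∣⊤∣≡n d) ⟩
    d C k                              ∎
    where
    open ≡-Reasoning
    X = subsetsOfSize d k

  count-disj : ∀ (y : Subset d) k → count (λ x → disj x y) (subsetsOfSize d k) ≡ (d ∸ ∣ y ∣) C k
  count-disj {d} y k = begin
    count (λ x → disj x y) X            ≡⟨ ∑-cong X (λ x _ → cong 𝟙 (disj≡does-⊆∁ x y)) ⟩
    count (λ x → does (x ⊆? ∁ y)) X     ≡⟨ count-⊆ (∁ y) k ⟩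
    ∣ ∁ y ∣ C k                         ≡⟨ cong (_C k) (∣∁p∣≡n∸∣p∣ y) ⟩
    (d ∸ ∣ y ∣) C k                     ∎
    where
    open ≡-Reasoning
    X = subsetsOfSize d k

module Protocols where

  open import Defs using (Protocol; leaf; alice; bob; run; aliceBits; bobBits)
  open Lists
  open import Data.Bool.Base using (Bool; true; false; not; _∧_; if_then_else_)
  open import Data.Bool.Properties using (∧-conicalˡ; ∧-conicalʳ; not-injective)
  open import Data.Empty using (⊥; ⊥-elim)
  open import Data.List.Base using (List)
  open import Data.List.Membership.Propositional using (_∈_)
  open import Data.Nat.Base
  open import Data.Nat.Properties
  open import Data.Nat.Tactic.RingSolver using (solve-∀)
  open import Data.Sum using (_⊎_; inj₁; inj₂)
  open import Function using (_∘_)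
  open import Relation.Binary.PropositionalEquality

  run-alice-silent : ∀ {X Y : Set} (π : Protocol X Y) x x′ y →
                     aliceBits π x y ≡ 0 → aliceBits π x′ y ≡ 0 → run π x y ≡ run π x′ y
  run-alice-silent (leaf o)      x x′ y _  _  = refl
  run-alice-silent (alice m t e) x x′ y () _
  run-alice-silent (bob m t e)   x x′ y h  h′ with m y
  ... | true  = run-alice-silent t x x′ y h h′
  ... | false = run-alice-silent e x x′ y h h′

  module Rectangles {X Y : Set} (xs : List X) (ys : List Y) (f : X → Y → Bool) where

    OnRectangle : (X → Bool) → (Y → Bool) → (X → Y → Set) → Set
    OnRectangle P Q R = ∀ x y → x ∈ xs → y ∈ ys → P x ≡ true → Q y ≡ true → R x y

    accepted : Protocol X Y → (X → Bool) → (Y → Bool) → ℕ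
    accepted π P Q = ∑ xs (λ x → ∑ ys (λ y → 𝟙 (P x ∧ Q y ∧ run π x y)))

    record Within (A B : ℕ) (π : Protocol X Y) (x : X) (y : Y) : Set where
      constructor within
      field
        aliceBits≤ : aliceBits π x y ≤ A
        bobBits≤   : bobBits π x y ≤ B
        accepts⇒f  : run π x y ≡ true → f x y ≡ true
    open Within

    private
      ∑∑-+ : {g g₁ g₂ : X → Y → ℕ} → (∀ x y → g x y ≡ g₁ x y + g₂ x y) →
             ∑ xs (λ x → ∑ ys (g x)) ≡ ∑ xs (λ x → ∑ ys (g₁ x)) + ∑ xs (λ x → ∑ ys (g₂ x))
      ∑∑-+ {g} {g₁} {g₂} g≡ = trans
        (∑-cong xs (λ x _ → trans (∑-cong ys (λ y _ → g≡ x y)) (∑-distrib-+ ys (g₁ x) (g₂ x))))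
        (∑-distrib-+ xs _ _)

    accepted-accept : ∀ P Q → accepted (leaf true) P Q ≡ count P xs * count Q ys
    accepted-accept P Q = trans
      (∑-cong xs (λ x _ → trans (∑-cong ys (λ y _ → 𝟙-∧ (P x) (Q y))) (*-distribˡ-∑ (𝟙 (P x)) ys (𝟙 ∘ Q))))
      (*-distribʳ-∑ (count Q ys) xs (𝟙 ∘ P))
      where
      𝟙-∧ : ∀ p q → 𝟙 (p ∧ q ∧ true) ≡ 𝟙 p * 𝟙 q
      𝟙-∧ true  true  = refl
      𝟙-∧ true  false = refl
      𝟙-∧ false q     = refl

    accepted-reject : ∀ P Q → accepted (leaf false) P Q ≡ 0
    accepted-reject P Q = ∑-≡0 xs (λ x _ → ∑-≡0 ys (λ y _ → cong 𝟙 (∧-false (P x) (Q y))))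
      where
      ∧-false : ∀ p q → (p ∧ q ∧ false) ≡ false
      ∧-false true  true  = refl
      ∧-false true  false = refl
      ∧-false false q     = refl

    accepted-empty : ∀ π P Q → OnRectangle P Q (λ _ _ → ⊥) → accepted π P Q ≡ 0
    accepted-empty π P Q empty = ∑-≡0 xs (λ x x∈ → ∑-≡0 ys (λ y y∈ → vanishes x y x∈ y∈))
      where
      vanishes : ∀ x y → x ∈ xs → y ∈ ys → 𝟙 (P x ∧ Q y ∧ run π x y) ≡ 0
      vanishes x y x∈ y∈ with P x in px | Q y in qy
      ... | true  | true  = ⊥-elim (empty x y x∈ y∈ px qy)
      ... | true  | false = refl
      ... | false | _     = refl

    accepted-alice : ∀ m t e P Q →
      accepted (alice m t e) P Q ≡ accepted t (λ x → P x ∧ m x) Q + accepted e (λ x → P x ∧ not (m x)) Q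
    accepted-alice m t e P Q = ∑∑-+ (λ x y → 𝟙-split (P x) (m x) (Q y) (run t x y) (run e x y))
      where
      𝟙-split : ∀ p b q r₁ r₂ → 𝟙 (p ∧ q ∧ (if b then r₁ else r₂)) ≡ 𝟙 ((p ∧ b) ∧ q ∧ r₁) + 𝟙 ((p ∧ not b) ∧ q ∧ r₂)
      𝟙-split false b     q r₁ r₂ = refl
      𝟙-split true  true  q r₁ r₂ = sym (+-identityʳ _)
      𝟙-split true  false q r₁ r₂ = refl

    accepted-bob : ∀ m t e P Q →
      accepted (bob m t e) P Q ≡ accepted t P (λ y → Q y ∧ m y) + accepted e P (λ y → Q y ∧ not (m y))
    accepted-bob m t e P Q = ∑∑-+ (λ x y → 𝟙-split (P x) (m y) (Q y) (run t x y) (run e x y))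
      where
      𝟙-split : ∀ p b q r₁ r₂ → 𝟙 (p ∧ q ∧ (if b then r₁ else r₂)) ≡ 𝟙 (p ∧ (q ∧ b) ∧ r₁) + 𝟙 (p ∧ (q ∧ not b) ∧ r₂)
      𝟙-split false b     q     r₁ r₂ = refl
      𝟙-split true  b     false r₁ r₂ = refl
      𝟙-split true  true  true  r₁ r₂ = sym (+-identityʳ _)
      𝟙-split true  false true  r₁ r₂ = refl

    restrictˡ : ∀ {P Q R S} (P′ : X → Bool) → (∀ {x y} → P′ x ≡ true → R x y → S x y) →
                OnRectangle P Q R → OnRectangle (λ x → P x ∧ P′ x) Q S
    restrictˡ {P} P′ R⇒S h x y x∈ y∈ px qy =
      R⇒S (∧-conicalʳ (P x) (P′ x) px) (h x y x∈ y∈ (∧-conicalˡ (P x) (P′ x) px) qy)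

    restrictʳ : ∀ {P Q R S} (Q′ : Y → Bool) → (∀ {x y} → Q′ y ≡ true → R x y → S x y) →
                OnRectangle P Q R → OnRectangle P (λ y → Q y ∧ Q′ y) S
    restrictʳ {Q = Q} Q′ R⇒S h x y x∈ y∈ px qy =
      R⇒S (∧-conicalʳ (Q y) (Q′ y) qy) (h x y x∈ y∈ px (∧-conicalˡ (Q y) (Q′ y) qy))

    module _ {A B : ℕ} {x : X} {y : Y} where

      within-aliceᵗ : ∀ {m t e} → m x ≡ true → Within (suc A) B (alice m t e) x y → Within A B t x y
      within-aliceᵗ mx (within a b r) rewrite mx = within (s≤s⁻¹ a) b r

      within-aliceᶠ : ∀ {m t e} → m x ≡ false → Within (suc A) B (alice m t e) x y → Within A B e x y
      within-aliceᶠ mx (within a b r) rewrite mx = within (s≤s⁻¹ a) b r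

      within-bobᵗ : ∀ {m t e} → m y ≡ true → Within A (suc B) (bob m t e) x y → Within A B t x y
      within-bobᵗ my (within a b r) rewrite my = within a (s≤s⁻¹ b) r

      within-bobᶠ : ∀ {m t e} → m y ≡ false → Within A (suc B) (bob m t e) x y → Within A B e x y
      within-bobᶠ my (within a b r) rewrite my = within a (s≤s⁻¹ b) r

    private
      ≤0-absurd : ∀ {n} → suc n ≤ 0 → ⊥
      ≤0-absurd ()

    module _ (M s t : ℕ)
      (corruption : ∀ P Q → OnRectangle P Q (λ x y → f x y ≡ true) → M * count P xs ≤ s ⊎ M * count Q ys ≤ t) where

      private
        vanishing : ∀ π A B P Q → accepted π P Q ≡ 0 →
                    M * accepted π P Q ≤ 2 ^ A * s * count Q ys + 2 ^ B * t * count P xs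
        vanishing π A B P Q none = ≤-trans (≤-reflexive (trans (cong (M *_) none) (*-zeroʳ M))) z≤n

      accepted-bound : ∀ π A B P Q → OnRectangle P Q (Within A B π) →
                       M * accepted π P Q ≤ 2 ^ A * s * count Q ys + 2 ^ B * t * count P xs
      accepted-bound (leaf true) A B P Q h = begin
        M * accepted (leaf true) P Q              ≡⟨ cong (M *_) (accepted-accept P Q) ⟩
        M * (count P xs * count Q ys)             ≤⟨ leaf-bound (corruption P Q (λ x y x∈ y∈ px qy → accepts⇒f (h x y x∈ y∈ px qy) refl)) ⟩
        s * count Q ys + t * count P xs           ≤⟨ +-mono-≤ (*-monoˡ-≤ (count Q ys) (m≤n*m s (2 ^ A) {{m^n≢0 2 A}}))
                                                              (*-monoˡ-≤ (count P xs) (m≤n*m t (2 ^ B) {{m^n≢0 2 B}})) ⟩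
        2 ^ A * s * count Q ys + 2 ^ B * t * count P xs ∎
        where
        open ≤-Reasoning
        leaf-bound : M * count P xs ≤ s ⊎ M * count Q ys ≤ t → M * (count P xs * count Q ys) ≤ s * count Q ys + t * count P xs
        leaf-bound (inj₁ MP≤s) = begin
          M * (count P xs * count Q ys)   ≡⟨ *-assoc M (count P xs) (count Q ys) ⟨
          M * count P xs * count Q ys     ≤⟨ *-monoˡ-≤ (count Q ys) MP≤s ⟩
          s * count Q ys                  ≤⟨ m≤m+n (s * count Q ys) (t * count P xs) ⟩
          s * count Q ys + t * count P xs ∎
        leaf-bound (inj₂ MQ≤t) = begin
          M * (count P xs * count Q ys)   ≡⟨ cong (M *_) (*-comm (count P xs) (count Q ys)) ⟩
          M * (count Q ys * count P xs)   ≡⟨ *-assoc M (count Q ys) (count P xs) ⟨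
          M * count Q ys * count P xs     ≤⟨ *-monoˡ-≤ (count P xs) MQ≤t ⟩
          t * count P xs                  ≤⟨ m≤n+m (t * count P xs) (s * count Q ys) ⟩
          s * count Q ys + t * count P xs ∎
      accepted-bound π@(leaf false)  A     B P Q h = vanishing π A B P Q (accepted-reject P Q)
      accepted-bound π@(alice _ _ _) zero  B P Q h =
        vanishing π zero B P Q (accepted-empty π P Q (λ x y x∈ y∈ px qy → ≤0-absurd (aliceBits≤ (h x y x∈ y∈ px qy))))
      accepted-bound (alice m t′ e) (suc A) B P Q h = begin
        M * accepted (alice m t′ e) P Q                         ≡⟨ cong (M *_) (accepted-alice m t′ e P Q) ⟩
        M * (accepted t′ Pᵗ Q + accepted e Pᶠ Q)                ≡⟨ *-distribˡ-+ M (accepted t′ Pᵗ Q) _ ⟩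
        M * accepted t′ Pᵗ Q + M * accepted e Pᶠ Q              ≤⟨ +-mono-≤ (accepted-bound t′ A B Pᵗ Q hᵗ) (accepted-bound e A B Pᶠ Q hᶠ) ⟩
        (2 ^ A * s * cQ + 2 ^ B * t * count Pᵗ xs) + (2 ^ A * s * cQ + 2 ^ B * t * count Pᶠ xs)
                                                                ≡⟨ merge (2 ^ A) s cQ (2 ^ B) t (count Pᵗ xs) (count Pᶠ xs) ⟩
        2 ^ suc A * s * cQ + 2 ^ B * t * (count Pᵗ xs + count Pᶠ xs) ≡⟨ cong (λ c → 2 ^ suc A * s * cQ + 2 ^ B * t * c) (count-split P m xs) ⟨
        2 ^ suc A * s * cQ + 2 ^ B * t * count P xs             ∎
        where
        open ≤-Reasoning
        cQ = count Q ys
        Pᵗ = λ x → P x ∧ m x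
        Pᶠ = λ x → P x ∧ not (m x)
        hᵗ : OnRectangle Pᵗ Q (Within A B t′)
        hᵗ = restrictˡ m within-aliceᵗ h
        hᶠ : OnRectangle Pᶠ Q (Within A B e)
        hᶠ = restrictˡ (not ∘ m) (within-aliceᶠ ∘ not-injective) h
        merge : ∀ a s q b t c₁ c₂ → (a * s * q + b * t * c₁) + (a * s * q + b * t * c₂) ≡ 2 * a * s * q + b * t * (c₁ + c₂)
        merge = solve-∀
      accepted-bound π@(bob _ _ _)   A zero  P Q h =
        vanishing π A zero P Q (accepted-empty π P Q (λ x y x∈ y∈ px qy → ≤0-absurd (bobBits≤ (h x y x∈ y∈ px qy))))
      accepted-bound (bob m t′ e) A (suc B) P Q h = begin
        M * accepted (bob m t′ e) P Q                           ≡⟨ cong (M *_) (accepted-bob m t′ e P Q) ⟩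
        M * (accepted t′ P Qᵗ + accepted e P Qᶠ)                ≡⟨ *-distribˡ-+ M (accepted t′ P Qᵗ) _ ⟩
        M * accepted t′ P Qᵗ + M * accepted e P Qᶠ              ≤⟨ +-mono-≤ (accepted-bound t′ A B P Qᵗ hᵗ) (accepted-bound e A B P Qᶠ hᶠ) ⟩
        (2 ^ A * s * count Qᵗ ys + 2 ^ B * t * cP) + (2 ^ A * s * count Qᶠ ys + 2 ^ B * t * cP)
                                                                ≡⟨ merge (2 ^ A) s cP (2 ^ B) t (count Qᵗ ys) (count Qᶠ ys) ⟩
        2 ^ A * s * (count Qᵗ ys + count Qᶠ ys) + 2 ^ suc B * t * cP ≡⟨ cong (λ c → 2 ^ A * s * c + 2 ^ suc B * t * cP) (count-split Q m ys) ⟨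
        2 ^ A * s * count Q ys + 2 ^ suc B * t * cP             ∎
        where
        open ≤-Reasoning
        cP = count P xs
        Qᵗ = λ y → Q y ∧ m y
        Qᶠ = λ y → Q y ∧ not (m y)
        hᵗ : OnRectangle P Qᵗ (Within A B t′)
        hᵗ = restrictʳ m within-bobᵗ h
        hᶠ : OnRectangle P Qᶠ (Within A B e)
        hᶠ = restrictʳ (not ∘ m) (within-bobᶠ ∘ not-injective) h
        merge : ∀ a s p b t c₁ c₂ → (a * s * c₁ + b * t * p) + (a * s * c₂ + b * t * p) ≡ a * s * (c₁ + c₂) + 2 * b * t * p
        merge = solve-∀

module Estimates where

  open Binomials using (C-ratio; C-ratio-≤)
  open import Data.Nat.Base
  open import Data.Nat.Properties
  open import Data.Nat.Combinatorics using (_C_)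
  open import Data.Nat.Tactic.RingSolver using (solve-∀)
  open import Data.Product using (_,_)
  open import Data.Unit using (tt)
  open import Relation.Binary.PropositionalEquality

  ^-distribʳ-* : ∀ m n o → (m * n) ^ o ≡ m ^ o * n ^ o
  ^-distribʳ-* m n zero    = refl
  ^-distribʳ-* m n (suc o) = trans (cong (m * n *_) (^-distribʳ-* m n o)) (interchange m n (m ^ o) (n ^ o))
    where
    interchange : ∀ a b c d → a * b * (c * d) ≡ a * c * (b * d)
    interchange = solve-∀

  2^a*p^k≤q^k : ∀ {p q n} → 2 * p ^ n ≤ q ^ n → p ≤ q → ∀ a {k} → n * a ≤ k → 2 ^ a * p ^ k ≤ q ^ k
  2^a*p^k≤q^k {p} {q} {n} 2pⁿ≤qⁿ p≤q a na≤k with m≤n⇒∃[o]m+o≡n na≤k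
  ... | o , refl = begin
    2 ^ a * p ^ (n * a + o)           ≡⟨ cong (2 ^ a *_) (split p) ⟩
    2 ^ a * ((p ^ n) ^ a * p ^ o)     ≡⟨ *-assoc (2 ^ a) _ _ ⟨
    2 ^ a * (p ^ n) ^ a * p ^ o       ≡⟨ cong (_* p ^ o) (^-distribʳ-* 2 (p ^ n) a) ⟨
    (2 * p ^ n) ^ a * p ^ o           ≤⟨ *-mono-≤ (^-monoˡ-≤ a 2pⁿ≤qⁿ) (^-monoˡ-≤ o p≤q) ⟩
    (q ^ n) ^ a * q ^ o               ≡⟨ split q ⟨
    q ^ (n * a + o)                   ∎
    where
    open ≤-Reasoning
    split : ∀ r → r ^ (n * a + o) ≡ (r ^ n) ^ a * r ^ o
    split r = trans (^-distribˡ-+-* r (n * a) o) (cong (_* r ^ o) (sym (^-*-assoc r n a)))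

  c*a^k≤b^k : ∀ {c a b k₀} → c * a ^ k₀ ≤ b ^ k₀ → a ≤ b → ∀ {k} → k₀ ≤ k → c * a ^ k ≤ b ^ k
  c*a^k≤b^k {c} {a} {b} {k₀} base a≤b k₀≤k with m≤n⇒∃[o]m+o≡n k₀≤k
  ... | o , refl = begin
    c * a ^ (k₀ + o)          ≡⟨ cong (c *_) (^-distribˡ-+-* a k₀ o) ⟩
    c * (a ^ k₀ * a ^ o)      ≡⟨ *-assoc c _ _ ⟨
    c * a ^ k₀ * a ^ o        ≤⟨ *-mono-≤ base (^-monoˡ-≤ o a≤b) ⟩
    b ^ k₀ * b ^ o            ≡⟨ ^-distribˡ-+-* b k₀ o ⟨
    b ^ (k₀ + o)              ∎
    where open ≤-Reasoning

  C-gap : ∀ {a k u n} α β → 24 * a ≤ k → k ≤ n → α * u ≤ β * n → β ≤ α → 0 < α →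
          3 * (25 * β) ^ k ≤ (24 * α) ^ k → 3 * 2 ^ a * (u C k) ≤ n C k
  C-gap {a} {k} {u} {n} α β 24a≤k k≤n αu≤βn β≤α 0<α 3[25β]ᵏ≤[24α]ᵏ =
    *-cancelʳ-≤ (3 * 2 ^ a * (u C k)) (n C k) ((24 * α) ^ k) {{m^n≢0 (24 * α) k {{>-nonZero (*-monoʳ-< 24 0<α)}}}} (begin
      3 * 2 ^ a * (u C k) * (24 * α) ^ k            ≡⟨ cong (3 * 2 ^ a * (u C k) *_) (^-distribʳ-* 24 α k) ⟩
      3 * 2 ^ a * (u C k) * (24 ^ k * α ^ k)        ≡⟨ regroupˡ 3 (2 ^ a) (u C k) (24 ^ k) (α ^ k) ⟩
      3 * (2 ^ a * 24 ^ k) * ((u C k) * α ^ k)      ≤⟨ *-mono-≤ (*-monoʳ-≤ 3 (2^a*p^k≤q^k {24} {25} {24} 2*24²⁴≤25²⁴ (n≤1+n 24) a 24a≤k))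
                                                               (C-ratio-≤ k α β k≤n αu≤βn β≤α) ⟩
      3 * 25 ^ k * ((n C k) * β ^ k)                ≡⟨ regroupʳ 3 (25 ^ k) (n C k) (β ^ k) ⟩
      (n C k) * (3 * (25 ^ k * β ^ k))              ≡⟨ cong (λ z → (n C k) * (3 * z)) (^-distribʳ-* 25 β k) ⟨
      (n C k) * (3 * (25 * β) ^ k)                  ≤⟨ *-monoʳ-≤ (n C k) 3[25β]ᵏ≤[24α]ᵏ ⟩
      (n C k) * (24 * α) ^ k                        ∎)
    where
    open ≤-Reasoning
    2*24²⁴≤25²⁴ : 2 * 24 ^ 24 ≤ 25 ^ 24
    2*24²⁴≤25²⁴ = ≤ᵇ⇒≤ (2 * 24 ^ 24) (25 ^ 24) tt
    regroupˡ : ∀ c x y z w → c * x * y * (z * w) ≡ c * (x * z) * (y * w)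
    regroupˡ = solve-∀
    regroupʳ : ∀ c x y z → c * x * (y * z) ≡ y * (c * (x * z))
    regroupʳ = solve-∀

  l+l<d∸l : ∀ {d l} → 3 * l < d → l + l < d ∸ l
  l+l<d∸l {d} {l} 3l<d = +-cancelˡ-< l (l + l) (d ∸ l) (begin-strict
    l + (l + l)    ≡⟨ 3l≡l+[l+l] l ⟨
    3 * l          <⟨ 3l<d ⟩
    d              ≡⟨ m+[n∸m]≡n (≤-trans (m≤n*m l 3) (<⇒≤ 3l<d)) ⟨
    l + (d ∸ l)    ∎)
    where
    open ≤-Reasoning
    3l≡l+[l+l] : ∀ l → 3 * l ≡ l + (l + l)
    3l≡l+[l+l] = solve-∀

  C-∸-ratio : ∀ {d k l} → k ≤ l → 3 * l < d → (d C k) * d ^ k ≤ ((d ∸ l) C k) * (d + 3 * l) ^ k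
  C-∸-ratio {d} {k} {l} k≤l 3l<d with m≤n⇒∃[o]m+o≡n (≤-trans (m≤n*m l 3) (<⇒≤ 3l<d))
  ... | n , refl rewrite m+n∸m≡n l n = C-ratio k (l + n + 3 * l) (l + n) k≤n step
    where
    l+l<n : l + l < n
    l+l<n = subst (l + l <_) (m+n∸m≡n l n) (l+l<d∸l {l + n} {l} 3l<d)
    k≤n : k ≤ n
    k≤n = ≤-trans k≤l (≤-trans (m≤m+n l l) (<⇒≤ l+l<n))
    shrink : ∀ {i m} → i ≤ l → l < m → (l + (i + m)) * (l + m) ≤ (l + (i + m) + 3 * l) * m
    shrink {i} {m} i≤l l<m = +-cancelʳ-≤ (l * (m + m)) _ _ (begin
      (l + (i + m)) * (l + m) + l * (m + m)   ≡⟨ expand l i m ⟩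
      (l + (i + m) + 3 * l) * m + l * (i + l) ≤⟨ +-monoʳ-≤ _ (*-monoʳ-≤ l (+-mono-≤ (≤-trans i≤l (<⇒≤ l<m)) (<⇒≤ l<m))) ⟩
      (l + (i + m) + 3 * l) * m + l * (m + m) ∎)
      where
      open ≤-Reasoning
      expand : ∀ l i m → (l + (i + m)) * (l + m) + l * (m + m) ≡ (l + (i + m) + 3 * l) * m + l * (i + l)
      expand = solve-∀
    drop : ∀ l i m → l + (i + m) ∸ i ≡ l + m
    drop l i m = trans (cong (_∸ i) (x+[y+z]≡y+[x+z] l i m)) (m+n∸m≡n i (l + m))
      where
      x+[y+z]≡y+[x+z] : ∀ x y z → x + (y + z) ≡ y + (x + z)
      x+[y+z]≡y+[x+z] = solve-∀
    step : ∀ i → i < k → (l + n) * (l + n ∸ i) ≤ (l + n + 3 * l) * (n ∸ i)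
    step i i<k with m≤n⇒∃[o]m+o≡n (≤-trans (<⇒≤ i<k) k≤n)
    ... | m , refl rewrite m+n∸m≡n i m | drop l i m =
      shrink i≤l (+-cancelˡ-< l l m (<-≤-trans l+l<n (+-monoˡ-≤ m i≤l)))
      where
      i≤l : i ≤ l
      i≤l = ≤-trans (<⇒≤ i<k) k≤l

  complement-bound : ∀ {l v u w} → l + v ≡ u + w → 4 * v < 5 * u → l + l < v → 10 * w ≤ 7 * v
  complement-bound {l} {v} {u} {w} l+v≡u+w 4v<5u l+l<v = <⇒≤ (+-cancelʳ-< (8 * v) (10 * w) (7 * v) (begin-strict
    10 * w + 8 * v          ≡⟨ 10w+8v≡10w+2[4v] w v ⟩
    10 * w + 2 * (4 * v)    <⟨ +-monoʳ-< (10 * w) (*-monoʳ-< 2 4v<5u) ⟩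
    10 * w + 2 * (5 * u)    ≡⟨ 10w+2[5u]≡10[u+w] w u ⟩
    10 * (u + w)            ≡⟨ cong (10 *_) l+v≡u+w ⟨
    10 * (l + v)            ≡⟨ 10[l+v]≡5[l+l]+10v l v ⟩
    5 * (l + l) + 10 * v    <⟨ +-monoˡ-< (10 * v) (*-monoʳ-< 5 l+l<v) ⟩
    5 * v + 10 * v          ≡⟨ 5v+10v≡7v+8v v ⟩
    7 * v + 8 * v           ∎))
    where
    open ≤-Reasoning
    10w+8v≡10w+2[4v] : ∀ w v → 10 * w + 8 * v ≡ 10 * w + 2 * (4 * v)
    10w+8v≡10w+2[4v] = solve-∀
    10w+2[5u]≡10[u+w] : ∀ w u → 10 * w + 2 * (5 * u) ≡ 10 * (u + w)
    10w+2[5u]≡10[u+w] = solve-∀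
    10[l+v]≡5[l+l]+10v : ∀ l v → 10 * (l + v) ≡ 5 * (l + l) + 10 * v
    10[l+v]≡5[l+l]+10v = solve-∀
    5v+10v≡7v+8v : ∀ v → 5 * v + 10 * v ≡ 7 * v + 8 * v
    5v+10v≡7v+8v = solve-∀

module Rationals where

  open import Data.Integer.Base as ℤ using (+_)
  import Data.Integer.Properties as ℤ
  open import Data.Nat.Base as ℕ using (ℕ; suc)
  import Data.Nat.Properties as ℕ
  open import Data.Rational.Base using (ℚ; _+_; _*_; _/_; _≤_; _<_; 0ℚ; 1ℚ; toℚᵘ; Positive)
  open import Data.Rational.Properties
  open import Data.Rational.Unnormalised.Base as ℚᵘ using (mkℚᵘ; *≡*; *≤*; *<*)
  import Data.Rational.Unnormalised.Properties as ℚᵘ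
  open import Relation.Binary.PropositionalEquality

  fromℕ : ℕ → ℚ
  fromℕ n = + n / 1

  toℚᵘ-/ : ∀ n d → toℚᵘ (+ n / suc d) ℚᵘ.≃ mkℚᵘ (+ n) d
  toℚᵘ-/ n d = toℚᵘ-fromℚᵘ (mkℚᵘ (+ n) d)

  fromℕ-+ : ∀ m n → fromℕ (m ℕ.+ n) ≡ fromℕ m + fromℕ n
  fromℕ-+ m n = toℚᵘ-injective (ℚᵘ.≃-trans (toℚᵘ-/ (m ℕ.+ n) 0) (ℚᵘ.≃-trans (*≡* cross)
    (ℚᵘ.≃-sym (ℚᵘ.≃-trans (toℚᵘ-homo-+ (fromℕ m) (fromℕ n)) (ℚᵘ.+-cong (toℚᵘ-/ m 0) (toℚᵘ-/ n 0))))))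
    where
    cross : + (m ℕ.+ n) ℤ.* + 1 ≡ (+ m ℤ.* + 1 ℤ.+ + n ℤ.* + 1) ℤ.* + 1
    cross rewrite ℤ.*-identityʳ (+ m) | ℤ.*-identityʳ (+ n) | ℤ.*-identityʳ (+ (m ℕ.+ n)) = refl

  fromℕ-* : ∀ m n → fromℕ (m ℕ.* n) ≡ fromℕ m * fromℕ n
  fromℕ-* m n = toℚᵘ-injective (ℚᵘ.≃-trans (toℚᵘ-/ (m ℕ.* n) 0) (ℚᵘ.≃-trans (*≡* cross)
    (ℚᵘ.≃-sym (ℚᵘ.≃-trans (toℚᵘ-homo-* (fromℕ m) (fromℕ n)) (ℚᵘ.*-cong (toℚᵘ-/ m 0) (toℚᵘ-/ n 0))))))
    where
    cross : + (m ℕ.* n) ℤ.* + 1 ≡ (+ m ℤ.* + n) ℤ.* + 1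
    cross = cong (ℤ._* + 1) (ℤ.pos-* m n)

  fromℕ-mono-≤ : ∀ {m n} → m ℕ.≤ n → fromℕ m ≤ fromℕ n
  fromℕ-mono-≤ {m} {n} m≤n = toℚᵘ-cancel-≤
    (ℚᵘ.≤-respˡ-≃ (ℚᵘ.≃-sym (toℚᵘ-/ m 0)) (ℚᵘ.≤-respʳ-≃ (ℚᵘ.≃-sym (toℚᵘ-/ n 0))
      (*≤* (subst₂ ℤ._≤_ (sym (ℤ.*-identityʳ (+ m))) (sym (ℤ.*-identityʳ (+ n))) (ℤ.+≤+ m≤n)))))

  fromℕ-cancel-< : ∀ {m n} → fromℕ m < fromℕ n → m ℕ.< n
  fromℕ-cancel-< {m} {n} m<n with ℚᵘ.<-respˡ-≃ (toℚᵘ-/ m 0) (ℚᵘ.<-respʳ-≃ (toℚᵘ-/ n 0) (toℚᵘ-mono-< m<n))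
  ... | *<* m<ᶻn = ℤ.drop‿+<+ (subst₂ ℤ._<_ (ℤ.*-identityʳ (+ m)) (ℤ.*-identityʳ (+ n)) m<ᶻn)

  m/n*n≡m : ∀ m d → (+ m / suc d) * fromℕ (suc d) ≡ fromℕ m
  m/n*n≡m m d = toℚᵘ-injective (ℚᵘ.≃-trans (toℚᵘ-homo-* (+ m / suc d) (fromℕ (suc d)))
    (ℚᵘ.≃-trans (ℚᵘ.*-cong (toℚᵘ-/ m d) (toℚᵘ-/ (suc d) 0)) (ℚᵘ.≃-trans (*≡* cross) (ℚᵘ.≃-sym (toℚᵘ-/ m 0)))))
    where
    cross : (+ m ℤ.* + suc d) ℤ.* + 1 ≡ + m ℤ.* + (suc d ℕ.* 1)
    cross rewrite ℤ.*-identityʳ (+ m ℤ.* + suc d) | ℕ.*-identityʳ (suc d) = refl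

  fromℕ-nonNeg : ∀ n → 0ℚ ≤ fromℕ n
  fromℕ-nonNeg n = nonNegative⁻¹ _ {{normalize-nonNeg n 1}}

  /-nonNeg : ∀ m d → 0ℚ ≤ + m / suc d
  /-nonNeg m d = nonNegative⁻¹ _ {{normalize-nonNeg m (suc d)}}

  fromℕ-pos : ∀ {n} → 0 ℕ.< n → Positive (fromℕ n)
  fromℕ-pos {suc n} _ = normalize-pos (suc n) 1

  fromℕ-*-/ : ∀ k m d → fromℕ k * (+ m / suc d) ≡ + (k ℕ.* m) / suc d
  fromℕ-*-/ k m d = toℚᵘ-injective (ℚᵘ.≃-trans (toℚᵘ-homo-* (fromℕ k) (+ m / suc d))
    (ℚᵘ.≃-trans (ℚᵘ.*-cong (toℚᵘ-/ k 0) (toℚᵘ-/ m d)) (ℚᵘ.≃-trans (*≡* cross) (ℚᵘ.≃-sym (toℚᵘ-/ (k ℕ.* m) d)))))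
    where
    cross : (+ k ℤ.* + m) ℤ.* + suc d ≡ + (k ℕ.* m) ℤ.* + (suc d ℕ.+ 0)
    cross rewrite ℕ.+-identityʳ (suc d) = cong (ℤ._* + suc d) (sym (ℤ.pos-* k m))

  k≤[1+c]n⇒k/[1+c]≤n : ∀ {c k n} → k ℕ.≤ suc c ℕ.* n → (+ 1 / suc c) * fromℕ k ≤ fromℕ n
  k≤[1+c]n⇒k/[1+c]≤n {c} {k} {n} k≤[1+c]n = *-cancelʳ-≤-pos (fromℕ (suc c)) {{fromℕ-pos {suc c} (ℕ.s≤s ℕ.z≤n)}} (begin
    (+ 1 / suc c) * fromℕ k * fromℕ (suc c)    ≡⟨ trans (cong (_* fromℕ (suc c)) (*-comm (+ 1 / suc c) (fromℕ k))) (*-assoc (fromℕ k) _ _) ⟩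
    fromℕ k * ((+ 1 / suc c) * fromℕ (suc c))  ≡⟨ cong (fromℕ k *_) (m/n*n≡m 1 c) ⟩
    fromℕ k * 1ℚ                               ≡⟨ *-identityʳ (fromℕ k) ⟩
    fromℕ k                                    ≤⟨ fromℕ-mono-≤ (subst (k ℕ.≤_) (ℕ.*-comm (suc c) n) k≤[1+c]n) ⟩
    fromℕ (n ℕ.* suc c)                        ≡⟨ fromℕ-* n (suc c) ⟩
    fromℕ n * fromℕ (suc c)                    ∎)
    where open ≤-Reasoning

module Exponential where

  open Rationals
  open import Defs using (expTerm; expPartial)
  open import Data.Integer.Base using (+_)
  open import Data.Nat.Base using (ℕ; zero; suc)
  open import Data.Rational.Base using (ℚ; _+_; _*_; _/_; _≤_; 0ℚ; 1ℚ; nonNegative)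
  open import Data.Rational.Properties
  open import Data.Rational.Solver using (module +-*-Solver)
  open +-*-Solver using (solve; _:+_; _:*_; _:=_; con)
  open import Relation.Binary.PropositionalEquality

  infixr 8 _^_
  _^_ : ℚ → ℕ → ℚ
  x ^ zero  = 1ℚ
  x ^ suc n = x * x ^ n

  private variable
    x y : ℚ

  private
    *-nonNeg : ∀ {p q} → 0ℚ ≤ p → 0ℚ ≤ q → 0ℚ ≤ p * q
    *-nonNeg {p} {q} 0≤p 0≤q = nonNegative⁻¹ _ {{nonNeg*nonNeg⇒nonNeg p {{nonNegative 0≤p}} q {{nonNegative 0≤q}}}}

    +-nonNeg : ∀ {p q} → 0ℚ ≤ p → 0ℚ ≤ q → 0ℚ ≤ p + q
    +-nonNeg {p} {q} 0≤p 0≤q = nonNegative⁻¹ _ {{nonNeg+nonNeg⇒nonNeg p {{nonNegative 0≤p}} q {{nonNegative 0≤q}}}}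

    *-monoˡ-≤ : ∀ {p q} r → 0ℚ ≤ r → p ≤ q → p * r ≤ q * r
    *-monoˡ-≤ r 0≤r = *-monoʳ-≤-nonNeg r {{nonNegative 0≤r}}

    *-monoʳ-≤ : ∀ {p q} r → 0ℚ ≤ r → p ≤ q → r * p ≤ r * q
    *-monoʳ-≤ r 0≤r = *-monoˡ-≤-nonNeg r {{nonNegative 0≤r}}

    p≤p+q : ∀ p {q} → 0ℚ ≤ q → p ≤ p + q
    p≤p+q p 0≤q = ≤-trans (≤-reflexive (sym (+-identityʳ p))) (+-monoʳ-≤ p 0≤q)

  expTerm-nonNeg : 0ℚ ≤ x → ∀ n → 0ℚ ≤ expTerm x n
  expTerm-nonNeg 0≤x zero    = fromℕ-nonNeg 1
  expTerm-nonNeg 0≤x (suc n) = *-nonNeg (*-nonNeg (expTerm-nonNeg 0≤x n) 0≤x) (/-nonNeg 1 n)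

  expTerm-+ : 0ℚ ≤ x → 0ℚ ≤ y → ∀ n → expTerm x (suc n) + y * expTerm x n ≤ expTerm (x + y) (suc n)
  expTerm-+ {x} {y} _ _ zero = ≤-reflexive (first-term x y)
    where
    first-term : ∀ x y → 1ℚ * x * 1ℚ + y * 1ℚ ≡ 1ℚ * (x + y) * 1ℚ
    first-term = solve 2 (λ x y → con 1ℚ :* x :* con 1ℚ :+ y :* con 1ℚ := con 1ℚ :* (x :+ y) :* con 1ℚ) refl
  expTerm-+ {x} {y} 0≤x 0≤y (suc n) = begin
    a * x * c + y * a                       ≤⟨ p≤p+q _ (*-nonNeg (*-nonNeg (*-nonNeg 0≤y 0≤y) (expTerm-nonNeg 0≤x n)) (/-nonNeg 1 (suc n))) ⟩
    (a * x * c + y * a) + y * y * b * c     ≡⟨ expand ⟨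
    (a + y * b) * (x + y) * c               ≤⟨ *-monoˡ-≤ c (/-nonNeg 1 (suc n)) (*-monoˡ-≤ (x + y) (+-nonNeg 0≤x 0≤y) (expTerm-+ 0≤x 0≤y n)) ⟩
    expTerm (x + y) (suc n) * (x + y) * c   ∎
    where
    open ≤-Reasoning
    a = expTerm x (suc n)
    b = expTerm x n
    c = + 1 / suc (suc n)
    N = fromℕ (suc n)
    bx≡aN : b * x ≡ a * N
    bx≡aN = begin-equality
      b * x                         ≡⟨ *-identityʳ (b * x) ⟨
      b * x * 1ℚ                    ≡⟨ cong (b * x *_) (m/n*n≡m 1 n) ⟨
      b * x * ((+ 1 / suc n) * N)   ≡⟨ *-assoc (b * x) (+ 1 / suc n) N ⟨
      a * N                         ∎
    c[1+N]≡1 : c * (1ℚ + N) ≡ 1ℚ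
    c[1+N]≡1 = trans (cong (c *_) (sym (fromℕ-+ 1 (suc n)))) (m/n*n≡m 1 (suc n))
    distribute : ∀ a b x y c → (a + y * b) * (x + y) * c ≡ a * x * c + y * a * c + y * (b * x) * c + y * y * b * c
    distribute = solve 5 (λ a b x y c → (a :+ y :* b) :* (x :+ y) :* c
                                        := a :* x :* c :+ y :* a :* c :+ y :* (b :* x) :* c :+ y :* y :* b :* c) refl
    collect : ∀ a b x y c N → a * x * c + y * a * c + y * (a * N) * c + y * y * b * c
                              ≡ a * x * c + y * a * (c * (1ℚ + N)) + y * y * b * c
    collect = solve 6 (λ a b x y c N → a :* x :* c :+ y :* a :* c :+ y :* (a :* N) :* c :+ y :* y :* b :* c
                                       := a :* x :* c :+ y :* a :* (c :* (con 1ℚ :+ N)) :+ y :* y :* b :* c) refl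
    expand : (a + y * b) * (x + y) * c ≡ (a * x * c + y * a) + y * y * b * c
    expand = begin-equality
      (a + y * b) * (x + y) * c                              ≡⟨ distribute a b x y c ⟩
      a * x * c + y * a * c + y * (b * x) * c + y * y * b * c ≡⟨ cong (λ z → a * x * c + y * a * c + y * z * c + y * y * b * c) bx≡aN ⟩
      a * x * c + y * a * c + y * (a * N) * c + y * y * b * c ≡⟨ collect a b x y c N ⟩
      a * x * c + y * a * (c * (1ℚ + N)) + y * y * b * c     ≡⟨ cong (λ z → a * x * c + y * a * z + y * y * b * c) c[1+N]≡1 ⟩
      a * x * c + y * a * 1ℚ + y * y * b * c                 ≡⟨ cong (λ z → a * x * c + z + y * y * b * c) (*-identityʳ (y * a)) ⟩
      (a * x * c + y * a) + y * y * b * c                    ∎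

  expPartial-+ : 0ℚ ≤ x → 0ℚ ≤ y → ∀ j → expPartial x (suc j) + y * expPartial x j ≤ expPartial (x + y) (suc j)
  expPartial-+ {x} {y} 0≤x 0≤y zero = begin
    (1ℚ + expTerm x 1) + y * 1ℚ        ≡⟨ +-assoc 1ℚ (expTerm x 1) (y * 1ℚ) ⟩
    1ℚ + (expTerm x 1 + y * 1ℚ)        ≤⟨ +-monoʳ-≤ 1ℚ (expTerm-+ 0≤x 0≤y 0) ⟩
    1ℚ + expTerm (x + y) 1             ∎
    where open ≤-Reasoning
  expPartial-+ {x} {y} 0≤x 0≤y (suc j) = begin
    (E + T₁ + T₂) + y * (E + T₁)            ≡⟨ regroup E T₁ T₂ y ⟩
    (E + T₁ + y * E) + (T₂ + y * T₁)        ≤⟨ +-mono-≤ (expPartial-+ 0≤x 0≤y j) (expTerm-+ 0≤x 0≤y (suc j)) ⟩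
    expPartial (x + y) (suc (suc j))        ∎
    where
    open ≤-Reasoning
    E = expPartial x j
    T₁ = expTerm x (suc j)
    T₂ = expTerm x (suc (suc j))
    regroup : ∀ E T₁ T₂ y → (E + T₁ + T₂) + y * (E + T₁) ≡ (E + T₁ + y * E) + (T₂ + y * T₁)
    regroup = solve 4 (λ E T₁ T₂ y → E :+ T₁ :+ T₂ :+ y :* (E :+ T₁) := (E :+ T₁ :+ y :* E) :+ (T₂ :+ y :* T₁)) refl

  [1+y]*expPartial≤expPartial : 0ℚ ≤ x → 0ℚ ≤ y → ∀ j → (1ℚ + y) * expPartial x j ≤ expPartial (x + y) (suc j)
  [1+y]*expPartial≤expPartial {x} {y} 0≤x 0≤y j = begin
    (1ℚ + y) * E                            ≡⟨ solve 2 (λ y E → (con 1ℚ :+ y) :* E := E :+ y :* E) refl y E ⟩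
    E + y * E                               ≤⟨ +-monoˡ-≤ (y * E) (p≤p+q E (expTerm-nonNeg 0≤x (suc j))) ⟩
    expPartial x (suc j) + y * E            ≤⟨ expPartial-+ 0≤x 0≤y j ⟩
    expPartial (x + y) (suc j)              ∎
    where
    open ≤-Reasoning
    E = expPartial x j

  [1+y]^k≤expPartial : 0ℚ ≤ y → ∀ k → (1ℚ + y) ^ k ≤ expPartial (fromℕ k * y) k
  [1+y]^k≤expPartial 0≤y zero    = ≤-refl
  [1+y]^k≤expPartial {y} 0≤y (suc k) = begin
    (1ℚ + y) * (1ℚ + y) ^ k                  ≤⟨ *-monoʳ-≤ (1ℚ + y) (+-nonNeg (fromℕ-nonNeg 1) 0≤y) ([1+y]^k≤expPartial 0≤y k) ⟩
    (1ℚ + y) * expPartial (fromℕ k * y) k    ≤⟨ [1+y]*expPartial≤expPartial (*-nonNeg (fromℕ-nonNeg k) 0≤y) 0≤y k ⟩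
    expPartial (fromℕ k * y + y) (suc k)     ≡⟨ cong (λ z → expPartial z (suc k)) ky+y≡[1+k]y ⟩
    expPartial (fromℕ (suc k) * y) (suc k)   ∎
    where
    open ≤-Reasoning
    ky+y≡[1+k]y : fromℕ k * y + y ≡ fromℕ (suc k) * y
    ky+y≡[1+k]y = trans (solve 2 (λ K y → K :* y :+ y := (con 1ℚ :+ K) :* y) refl (fromℕ k) y) (cong (_* y) (sym (fromℕ-+ 1 k)))

module ErrorBound where

  open Rationals
  open Exponential
  open import Defs using (expPartial)
  open import Data.Integer.Base using (+_)
  open import Data.Nat.Base as ℕ using (ℕ; zero; suc)
  import Data.Nat.Properties as ℕ
  open import Data.Rational.Base using (ℚ; _+_; _*_; _/_; _≤_; _<_; 0ℚ; 1ℚ; nonNegative)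
  open import Data.Rational.Properties
  open import Data.Rational.Solver using (module +-*-Solver)
  open +-*-Solver using (solve; _:+_; _:*_; _:=_; con)
  open import Relation.Binary.PropositionalEquality

  [1+m/n]^k*n^k : ∀ m d k → (1ℚ + + m / suc d) ^ k * fromℕ (suc d ℕ.^ k) ≡ fromℕ ((suc d ℕ.+ m) ℕ.^ k)
  [1+m/n]^k*n^k m d zero    = refl
  [1+m/n]^k*n^k m d (suc k) = begin
    (z * z ^ k) * fromℕ (n ℕ.* n ℕ.^ k)         ≡⟨ cong ((z * z ^ k) *_) (fromℕ-* n (n ℕ.^ k)) ⟩
    (z * z ^ k) * (fromℕ n * fromℕ (n ℕ.^ k))   ≡⟨ interchange z (z ^ k) (fromℕ n) (fromℕ (n ℕ.^ k)) ⟩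
    (z * fromℕ n) * (z ^ k * fromℕ (n ℕ.^ k))   ≡⟨ cong₂ _*_ z*n≡n+m ([1+m/n]^k*n^k m d k) ⟩
    fromℕ (n ℕ.+ m) * fromℕ ((n ℕ.+ m) ℕ.^ k)   ≡⟨ fromℕ-* (n ℕ.+ m) ((n ℕ.+ m) ℕ.^ k) ⟨
    fromℕ ((n ℕ.+ m) ℕ.^ suc k)                 ∎
    where
    open ≡-Reasoning
    n = suc d
    z = 1ℚ + + m / n
    interchange : ∀ a b c e → (a * b) * (c * e) ≡ (a * c) * (b * e)
    interchange = solve 4 (λ a b c e → (a :* b) :* (c :* e) := (a :* c) :* (b :* e)) refl
    z*n≡n+m : z * fromℕ n ≡ fromℕ (n ℕ.+ m)
    z*n≡n+m = begin
      (1ℚ + + m / n) * fromℕ n            ≡⟨ solve 2 (λ y N → (con 1ℚ :+ y) :* N := N :+ y :* N) refl (+ m / n) (fromℕ n) ⟩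
      fromℕ n + (+ m / n) * fromℕ n       ≡⟨ cong (λ w → fromℕ n + w) (m/n*n≡m m d) ⟩
      fromℕ n + fromℕ m                   ≡⟨ fromℕ-+ n m ⟨
      fromℕ (n ℕ.+ m)                     ∎

  fromℕ≤fromℕ*[1+m/n]^k : ∀ {m d k X C} → X ℕ.* suc d ℕ.^ k ℕ.≤ C ℕ.* (suc d ℕ.+ m) ℕ.^ k →
                          fromℕ X ≤ fromℕ C * (1ℚ + + m / suc d) ^ k
  fromℕ≤fromℕ*[1+m/n]^k {m} {d} {k} {X} {C} bound =
    *-cancelʳ-≤-pos (fromℕ (suc d ℕ.^ k)) {{fromℕ-pos (ℕ.m^n>0 (suc d) k)}} (begin
      fromℕ X * fromℕ (suc d ℕ.^ k)                ≡⟨ fromℕ-* X (suc d ℕ.^ k) ⟨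
      fromℕ (X ℕ.* suc d ℕ.^ k)                    ≤⟨ fromℕ-mono-≤ bound ⟩
      fromℕ (C ℕ.* (suc d ℕ.+ m) ℕ.^ k)            ≡⟨ fromℕ-* C ((suc d ℕ.+ m) ℕ.^ k) ⟩
      fromℕ C * fromℕ ((suc d ℕ.+ m) ℕ.^ k)        ≡⟨ cong (fromℕ C *_) ([1+m/n]^k*n^k m d k) ⟨
      fromℕ C * (z ^ k * fromℕ (suc d ℕ.^ k))      ≡⟨ *-assoc (fromℕ C) (z ^ k) _ ⟨
      fromℕ C * z ^ k * fromℕ (suc d ℕ.^ k)        ∎)
    where
    open ≤-Reasoning
    z = 1ℚ + + m / suc d

  c*err<C*Y : ∀ {c m d k err X Y C} .{{_ : ℕ.NonZero d}} (ε q : ℚ) → 0ℚ ≤ ε → fromℕ c * ε * q < 1ℚ →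
    (∀ N → expPartial (+ (k ℕ.* m) / d) N ≤ q) →
    fromℕ err ≤ ε * fromℕ X * fromℕ Y →
    X ℕ.* d ℕ.^ k ℕ.≤ C ℕ.* (d ℕ.+ m) ℕ.^ k →
    0 ℕ.< C ℕ.* Y →
    c ℕ.* err ℕ.< C ℕ.* Y
  c*err<C*Y {c} {m} {suc d} {k} {err} {X} {Y} {C} ε q 0≤ε cεq<1 expPartial≤q err≤εXY bound 0<CY =
    fromℕ-cancel-< (begin-strict
      fromℕ (c ℕ.* err)                  ≡⟨ fromℕ-* c err ⟩
      fromℕ c * fromℕ err                ≤⟨ c*-mono (≤-trans err≤εXY (*-monoʳ-≤-nonNeg (fromℕ Y) {{nonNegative (fromℕ-nonNeg Y)}}
                                                       (*-monoˡ-≤-nonNeg ε {{nonNegative 0≤ε}} X≤Cq))) ⟩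
      fromℕ c * (ε * (fromℕ C * q) * fromℕ Y) ≡⟨ regroup (fromℕ c) ε (fromℕ C) q (fromℕ Y) ⟩
      (fromℕ c * ε * q) * (fromℕ C * fromℕ Y) ≡⟨ cong (fromℕ c * ε * q *_) (fromℕ-* C Y) ⟨
      (fromℕ c * ε * q) * fromℕ (C ℕ.* Y)     <⟨ *-monoˡ-<-pos (fromℕ (C ℕ.* Y)) {{fromℕ-pos 0<CY}} cεq<1 ⟩
      1ℚ * fromℕ (C ℕ.* Y)                    ≡⟨ *-identityˡ _ ⟩
      fromℕ (C ℕ.* Y)                         ∎)
    where
    open ≤-Reasoning
    regroup : ∀ a e C q Y → a * (e * (C * q) * Y) ≡ (a * e * q) * (C * Y)
    regroup = solve 5 (λ a e C q Y → a :* (e :* (C :* q) :* Y) := (a :* e :* q) :* (C :* Y)) refl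
    c*-mono : ∀ {p r} → p ≤ r → fromℕ c * p ≤ fromℕ c * r
    c*-mono = *-monoˡ-≤-nonNeg (fromℕ c) {{nonNegative (fromℕ-nonNeg c)}}
    y = + m / suc d
    [1+y]^k≤q : (1ℚ + y) ^ k ≤ q
    [1+y]^k≤q = ≤-trans ([1+y]^k≤expPartial (/-nonNeg m d) k)
                        (subst (λ t → expPartial t k ≤ q) (sym (fromℕ-*-/ k m d)) (expPartial≤q k))
    X≤Cq : fromℕ X ≤ fromℕ C * q
    X≤Cq = ≤-trans (fromℕ≤fromℕ*[1+m/n]^k {m} {d} {k} {X} {C} bound) (*-monoˡ-≤-nonNeg (fromℕ C) {{nonNegative (fromℕ-nonNeg C)}} [1+y]^k≤q)

module Disjointness {d : ℕ} (k l : ℕ) (π : Protocol (Subset d) (Subset d)) (k≤l : k ℕ.≤ l) (3l<d : 3 ℕ.* l ℕ.< d) where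

  open Lists
  open Binomials using (C-pos; C-monoˡ-<)
  open Subsets
  open Protocols
  open Estimates
  open Rationals using (fromℕ; k≤[1+c]n⇒k/[1+c]≤n)
  open ErrorBound using (c*err<C*Y)
  open import Data.Bool.Base using (Bool; true; false)
  import Data.Bool.Properties as Bool
  open import Data.Empty using (⊥; ⊥-elim)
  open import Data.Fin.Subset using (∁; ⋃; ∣_∣)
  open import Data.Fin.Subset.Properties using (_⊆?_; ∣p∣≤n; ∣∁p∣≡n∸∣p∣)
  open import Data.Integer.Base using (+_)
  open import Data.List.Base using (List; length; filter)
  open import Data.List.Membership.Propositional using (_∈_)
  open import Data.List.Membership.Propositional.Properties using (∈-filter⁺; ∈-filter⁻)
  open import Data.Nat.Base
  open import Data.Nat.Properties
  open import Data.Nat.Combinatorics using (_C_)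
  import Data.Nat.DivMod as ℕ
  open import Data.Nat.Tactic.RingSolver using (solve-∀)
  open import Data.Product using (∃; _×_; _,_)
  open import Data.Rational.Base as ℚ using (ℚ; 0ℚ; 1ℚ)
  import Data.Rational.Properties as ℚ
  open import Data.Sum using (_⊎_; inj₁; inj₂; [_,_]′)
  open import Data.Unit using (tt)
  open import Function using (_∘_)
  open import Relation.Nullary using (Dec; yes; no; ¬_; contradiction)
  open import Relation.Nullary.Decidable using (dec-true)
  open import Relation.Binary.PropositionalEquality

  private
    l≤d : l ≤ d
    l≤d = ≤-trans (m≤n*m l 3) (<⇒≤ 3l<d)

    l<d : l < d
    l<d = ≤-<-trans (m≤n*m l 3) 3l<d

    l≤d∸l : l ≤ d ∸ l
    l≤d∸l = ≤-trans (m≤m+n l l) (<⇒≤ (l+l<d∸l {d} {l} 3l<d))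

    k≤d∸l : k ≤ d ∸ l
    k≤d∸l = ≤-trans k≤l l≤d∸l

    l≤d∸k : l ≤ d ∸ k
    l≤d∸k = ≤-trans l≤d∸l (∸-monoʳ-≤ d k≤l)

  X Y : List (Subset d)
  X = subsetsOfSize d k
  Y = subsetsOfSize d l

  open Rectangles X Y disj

  disjointPairs : ℕ
  disjointPairs = ∑ X (λ x → count (disj x) Y)

  errors : ℕ
  errors = ∑ X (λ x → count (λ y → _≠ᵇ_ {d} (run π x y) (disj x y)) Y)

  acceptedPairs : ℕ
  acceptedPairs = accepted π (λ _ → true) (λ _ → true)

  errorCount≡errors : errorCount π k l ≡ errors
  errorCount≡errors = trans (length-concatMap _ X) (∑-cong X (λ x _ → length-filter _ Y))

  disjointPairs≡ᵣ : disjointPairs ≡ length Y * ((d ∸ l) C k)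
  disjointPairs≡ᵣ = begin
    ∑ X (λ x → ∑ Y (λ y → 𝟙 (disj x y)))  ≡⟨ ∑-comm X Y (λ x y → 𝟙 (disj x y)) ⟩
    ∑ Y (λ y → count (λ x → disj x y) X)  ≡⟨ ∑-cong Y column ⟩
    ∑ Y (λ _ → (d ∸ l) C k)               ≡⟨ ∑-const Y _ ⟩
    length Y * ((d ∸ l) C k)              ∎
    where
    open ≡-Reasoning
    column : ∀ y → y ∈ Y → count (λ x → disj x y) X ≡ (d ∸ l) C k
    column y y∈Y = trans (count-disj y k) (cong (λ s → (d ∸ s) C k) (∈-subsetsOfSize⁻ y∈Y))

  disjointPairs≡ₗ : disjointPairs ≡ length X * ((d ∸ k) C l)
  disjointPairs≡ₗ = trans (∑-cong X row) (∑-const X _)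
    where
    row : ∀ x → x ∈ X → count (disj x) Y ≡ (d ∸ k) C l
    row x x∈X = begin
      count (disj x) Y              ≡⟨ ∑-cong Y (λ y _ → cong 𝟙 (disj-comm x y)) ⟩
      count (λ y → disj y x) Y      ≡⟨ count-disj x l ⟩
      (d ∸ ∣ x ∣) C l               ≡⟨ cong (λ s → (d ∸ s) C l) (∈-subsetsOfSize⁻ x∈X) ⟩
      (d ∸ k) C l                   ∎
      where open ≡-Reasoning

  disjointPairs≤accepted+errors : disjointPairs ≤ acceptedPairs + errors
  disjointPairs≤accepted+errors = begin
    disjointPairs                                               ≤⟨ ∑-mono-≤ X (λ x _ → ∑-mono-≤ Y (λ y _ → 𝟙-split (run π x y) (disj x y))) ⟩
    ∑ X (λ x → ∑ Y (λ y → 𝟙 (run π x y) + 𝟙 (run π x y ≠ disj x y)))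
      ≡⟨ ∑-cong X (λ x _ → ∑-distrib-+ Y _ _) ⟩
    ∑ X (λ x → ∑ Y (λ y → 𝟙 (run π x y)) + ∑ Y (λ y → 𝟙 (run π x y ≠ disj x y)))
      ≡⟨ ∑-distrib-+ X _ _ ⟩
    acceptedPairs + errors                                      ∎
    where
    open ≤-Reasoning
    _≠_ : Bool → Bool → Bool
    _≠_ = _≠ᵇ_ {d}
    𝟙-split : ∀ r s → 𝟙 s ≤ 𝟙 r + 𝟙 (r ≠ s)
    𝟙-split true  true  = ≤-refl
    𝟙-split false true  = ≤-refl
    𝟙-split r     false = z≤n

  typeII⇒sound : TypeII π k l → ∀ x y → x ∈ X → y ∈ Y → run π x y ≡ true → disj x y ≡ true
  typeII⇒sound typeII x y x∈X y∈Y accepts with disj x y in e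
  ... | true  = refl
  ... | false = contradiction (trans (sym accepts) (typeII x y (∈-subsetsOfSize⁻ x∈X) (∈-subsetsOfSize⁻ y∈Y) e)) λ ()

  module Corruption (a b : ℕ) (24a≤k : 24 * a ≤ k) (24b≤l : 24 * b ≤ l) (7≤k : 7 ≤ k) where

    private
      3*100ᵏ≤120ᵏ : 3 * (25 * 4) ^ k ≤ (24 * 5) ^ k
      3*100ᵏ≤120ᵏ = c*a^k≤b^k {3} {100} {120} {7} (≤ᵇ⇒≤ (3 * 100 ^ 7) (120 ^ 7) tt) (≤ᵇ⇒≤ 100 120 tt) 7≤k

      3*175ˡ≤240ˡ : 3 * (25 * 7) ^ l ≤ (24 * 10) ^ l
      3*175ˡ≤240ˡ = c*a^k≤b^k {3} {175} {240} {4} (≤ᵇ⇒≤ (3 * 175 ^ 4) (240 ^ 4) tt) (≤ᵇ⇒≤ 175 240 tt)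
                              (≤-trans (≤ᵇ⇒≤ 4 7 tt) (≤-trans 7≤k k≤l))

    rectangle-small : ∀ P Q → OnRectangle P Q (λ x y → disj x y ≡ true) →
                      3 * 2 ^ a * count P X ≤ (d ∸ l) C k ⊎ 3 * 2 ^ b * count Q Y ≤ (d ∸ k) C l
    rectangle-small P Q disjoint = by-size (5 * ∣ U ∣ ≤? 4 * (d ∸ l))
      where
      P? = λ x → P x Bool.≟ true
      U : Subset d
      U = ⋃ (filter P? X)
      P⊆U : count P X ≤ ∣ U ∣ C k
      P⊆U = ≤-trans (count-mono X (λ x x∈X px → dec-true (x ⊆? U) (⊆⋃ (∈-filter⁺ P? x∈X px))))
                    (≤-reflexive (count-⊆ U k))
      Q⊆∁U : count Q Y ≤ (d ∸ ∣ U ∣) C l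
      Q⊆∁U = ≤-trans (count-mono Y (λ y y∈Y qy → dec-true (y ⊆? ∁ U) (⊆∁-comm (⋃-least (filter P? X) (λ x x∈ →
                       let x∈X , px = ∈-filter⁻ P? x∈ in disj⇒⊆∁ (disjoint x y x∈X y∈Y px qy))))))
                     (≤-reflexive (trans (count-⊆ (∁ U) l) (cong (_C l) (∣∁p∣≡n∸∣p∣ U))))
      by-size : Dec (5 * ∣ U ∣ ≤ 4 * (d ∸ l)) →
                3 * 2 ^ a * count P X ≤ (d ∸ l) C k ⊎ 3 * 2 ^ b * count Q Y ≤ (d ∸ k) C l
      by-size (yes small) = inj₁ (≤-trans (*-monoʳ-≤ (3 * 2 ^ a) P⊆U)
        (C-gap {a} {k} {∣ U ∣} {d ∸ l} 5 4 24a≤k k≤d∸l small (≤ᵇ⇒≤ 4 5 tt) z<s 3*100ᵏ≤120ᵏ))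
      by-size (no large)  = inj₂ (≤-trans (*-monoʳ-≤ (3 * 2 ^ b) Q⊆∁U)
        (C-gap {b} {l} {d ∸ ∣ U ∣} {d ∸ k} 10 7 24b≤l l≤d∸k 10w≤7v (≤ᵇ⇒≤ 7 10 tt) z<s 3*175ˡ≤240ˡ))
        where
        l+v≡u+w : l + (d ∸ l) ≡ ∣ U ∣ + (d ∸ ∣ U ∣)
        l+v≡u+w = trans (m+[n∸m]≡n l≤d) (sym (m+[n∸m]≡n (∣p∣≤n U)))
        10w≤7v : 10 * (d ∸ ∣ U ∣) ≤ 7 * (d ∸ k)
        10w≤7v = ≤-trans (complement-bound {l} {d ∸ l} {∣ U ∣} l+v≡u+w (≰⇒> large) (l+l<d∸l {d} {l} 3l<d)) (*-monoʳ-≤ 7 (∸-monoʳ-≤ d k≤l))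

    three-accepted≤two-disjoint : (∀ x y → x ∈ X → y ∈ Y → Within a b π x y) → 3 * acceptedPairs ≤ 2 * disjointPairs
    three-accepted≤two-disjoint bounded = *-cancelˡ-≤ (2 ^ a * 2 ^ b) {{m*n≢0 (2 ^ a) (2 ^ b) {{m^n≢0 2 a}} {{m^n≢0 2 b}}}} (begin
      2 ^ a * 2 ^ b * (3 * acceptedPairs)       ≡⟨ AB[3n]≡3ABn (2 ^ a) (2 ^ b) acceptedPairs ⟩
      M * acceptedPairs                          ≤⟨ accepted-bound M s t corruption π a b _ _ (λ x y x∈ y∈ _ _ → bounded x y x∈ y∈) ⟩
      2 ^ a * s * count (λ _ → true) Y + 2 ^ b * t * count (λ _ → true) X
                                                 ≡⟨ cong₂ (λ p q → 2 ^ a * s * p + 2 ^ b * t * q) (count-true Y) (count-true X) ⟩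
      2 ^ a * (2 ^ b * C₁) * length Y + 2 ^ b * (2 ^ a * C₂) * length X
                                                 ≡⟨ factor-AB (2 ^ a) (2 ^ b) C₁ C₂ (length Y) (length X) ⟩
      2 ^ a * 2 ^ b * (length Y * C₁ + length X * C₂)
                                                 ≡⟨ cong₂ (λ p q → 2 ^ a * 2 ^ b * (p + q)) disjointPairs≡ᵣ disjointPairs≡ₗ ⟨
      2 ^ a * 2 ^ b * (disjointPairs + disjointPairs)
                                                 ≡⟨ cong (2 ^ a * 2 ^ b *_) (n+n≡2*n disjointPairs) ⟩
      2 ^ a * 2 ^ b * (2 * disjointPairs)        ∎)
      where
      open ≤-Reasoning
      C₁ = (d ∸ l) C k
      C₂ = (d ∸ k) C l
      M = 3 * 2 ^ a * 2 ^ b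
      s = 2 ^ b * C₁
      t = 2 ^ a * C₂
      scaleᵇ : ∀ A B n → B * (3 * A * n) ≡ 3 * A * B * n
      scaleᵇ = solve-∀
      scaleᵃ : ∀ A B n → A * (3 * B * n) ≡ 3 * A * B * n
      scaleᵃ = solve-∀
      corruption : ∀ P Q → OnRectangle P Q (λ x y → disj x y ≡ true) → M * count P X ≤ s ⊎ M * count Q Y ≤ t
      corruption P Q disjoint with rectangle-small P Q disjoint
      ... | inj₁ P-small = inj₁ (subst (_≤ s) (scaleᵇ (2 ^ a) (2 ^ b) (count P X)) (*-monoʳ-≤ (2 ^ b) P-small))
      ... | inj₂ Q-small = inj₂ (subst (_≤ t) (scaleᵃ (2 ^ a) (2 ^ b) (count Q Y)) (*-monoʳ-≤ (2 ^ a) Q-small))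
      AB[3n]≡3ABn : ∀ A B n → A * B * (3 * n) ≡ 3 * A * B * n
      AB[3n]≡3ABn = solve-∀
      factor-AB : ∀ A B c₁ c₂ y x → A * (B * c₁) * y + B * (A * c₂) * x ≡ A * B * (y * c₁ + x * c₂)
      factor-AB = solve-∀
      n+n≡2*n : ∀ n → n + n ≡ 2 * n
      n+n≡2*n = solve-∀

  silent-rejects : TypeII π k l → k ≤ 6 →
                   (∀ x y → x ∈ X → y ∈ Y → 24 * aliceBits π x y < k) → acceptedPairs ≡ 0
  silent-rejects typeII k≤6 cheap = ∑-≡0 X (λ x x∈X → ∑-≡0 Y (λ y y∈Y → cong 𝟙 (rejects x y x∈X y∈Y)))
    where
    silent : ∀ x y → x ∈ X → y ∈ Y → aliceBits π x y ≡ 0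
    silent x y x∈X y∈Y = n<1⇒n≡0 (*-cancelˡ-< 24 (aliceBits π x y) 1 (<-≤-trans (cheap x y x∈X y∈Y) (≤-trans k≤6 (≤ᵇ⇒≤ 6 24 tt))))
    rejects : ∀ x y → x ∈ X → y ∈ Y → run π x y ≡ false
    rejects x y x∈X y∈Y with count<length⇒∃false (λ x → disj x y) X fewer
      where
      fewer : count (λ x → disj x y) X < length X
      fewer = subst₂ _<_ (sym (trans (count-disj y k) (cong (λ s → (d ∸ s) C k) (∈-subsetsOfSize⁻ y∈Y))))
                         (sym (length-subsetsOfSize d k))
                         (C-monoˡ-< (≤-<-trans z≤n (cheap x y x∈X y∈Y)) k≤l l<d)
    ... | x₀ , x₀∈X , x₀-meets-y = trans (run-alice-silent π x x₀ y (silent x y x∈X y∈Y) (silent x₀ y x₀∈X y∈Y))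
                                        (typeII x₀ y (∈-subsetsOfSize⁻ x₀∈X) (∈-subsetsOfSize⁻ y∈Y) x₀-meets-y)

  three-errors<disjoint : .{{_ : NonZero d}} (ε q : ℚ) → 0ℚ ℚ.< ε → (+ 3 ℚ./ 1) ℚ.* ε ℚ.* q ℚ.< 1ℚ →
    (∀ N → expPartial (+ (3 * k * l) ℚ./ d) N ℚ.≤ q) → HasError≤ π k l ε →
    3 * errors < disjointPairs
  three-errors<disjoint ε q 0<ε 3εq<1 expPartial≤q hasError =
    subst (3 * errors <_) (trans (*-comm C₁ (length Y)) (sym disjointPairs≡ᵣ))
      (c*err<C*Y {3} {3 * l} {d} {k} {errors} {length X} {length Y} {C₁}
                    ε q (ℚ.<⇒≤ 0<ε) 3εq<1 expPartial≤q′ hasError′ growth (*-mono-< {0} {C₁} {0} {length Y} 0<C₁ 0<Y))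
    where
    C₁ = (d ∸ l) C k
    expPartial≤q′ : ∀ N → expPartial (+ (k * (3 * l)) ℚ./ d) N ℚ.≤ q
    expPartial≤q′ N = subst (λ n → expPartial (+ n ℚ./ d) N ℚ.≤ q) (3kl≡k[3l] k l) (expPartial≤q N)
      where
      3kl≡k[3l] : ∀ k l → 3 * k * l ≡ k * (3 * l)
      3kl≡k[3l] = solve-∀
    hasError′ : fromℕ errors ℚ.≤ ε ℚ.* fromℕ (length X) ℚ.* fromℕ (length Y)
    hasError′ = subst (λ e → fromℕ e ℚ.≤ ε ℚ.* fromℕ (length X) ℚ.* fromℕ (length Y)) errorCount≡errors hasError
    growth : length X * d ^ k ≤ C₁ * (d + 3 * l) ^ k
    growth = subst (λ n → n * d ^ k ≤ C₁ * (d + 3 * l) ^ k) (sym (length-subsetsOfSize d k)) (C-∸-ratio k≤l 3l<d)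
    0<C₁ : 0 < C₁
    0<C₁ = C-pos k≤d∸l
    0<Y : 0 < length Y
    0<Y = subst (0 <_) (sym (length-subsetsOfSize d l)) (C-pos l≤d)

  cheap-protocol-impossible : .{{_ : NonZero d}} (ε q : ℚ) → 0ℚ ℚ.< ε → (+ 3 ℚ./ 1) ℚ.* ε ℚ.* q ℚ.< 1ℚ →
    (∀ N → expPartial (+ (3 * k * l) ℚ./ d) N ℚ.≤ q) → HasError≤ π k l ε → TypeII π k l →
    (∀ x y → x ∈ X → y ∈ Y → 24 * aliceBits π x y < k) →
    (∀ x y → x ∈ X → y ∈ Y → 24 * bobBits π x y < l) → ⊥
  cheap-protocol-impossible ε q 0<ε 3εq<1 expPartial≤q hasError typeII cheapA cheapB = by-size (k ≤? 6)
    where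
    3errors<disjoint : 3 * errors < disjointPairs
    3errors<disjoint = three-errors<disjoint ε q 0<ε 3εq<1 expPartial≤q hasError
    24n<m⇒n≤m/24 : ∀ {n m} → 24 * n < m → n ≤ m ℕ./ 24
    24n<m⇒n≤m/24 {n} {m} 24n<m = subst (_≤ m ℕ./ 24) (ℕ.m*n/n≡m n 24) (ℕ./-monoˡ-≤ 24 (subst (_≤ m) (*-comm 24 n) (<⇒≤ 24n<m)))
    24*[m/24]≤m : ∀ m → 24 * (m ℕ./ 24) ≤ m
    24*[m/24]≤m m = subst (_≤ m) (*-comm (m ℕ./ 24) 24) (ℕ.m/n*n≤m m 24)
    bounded : ∀ x y → x ∈ X → y ∈ Y → Within (k ℕ./ 24) (l ℕ./ 24) π x y
    bounded x y x∈X y∈Y = within (24n<m⇒n≤m/24 (cheapA x y x∈X y∈Y)) (24n<m⇒n≤m/24 (cheapB x y x∈X y∈Y)) (typeII⇒sound typeII x y x∈X y∈Y)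
    by-size : Dec (k ≤ 6) → ⊥
    by-size (yes k≤6) = <⇒≱ 3errors<disjoint (begin
      disjointPairs            ≤⟨ disjointPairs≤accepted+errors ⟩
      acceptedPairs + errors   ≡⟨ cong (_+ errors) (silent-rejects typeII k≤6 cheapA) ⟩
      errors                   ≤⟨ m≤n*m errors 3 ⟩
      3 * errors               ∎)
      where open ≤-Reasoning
    by-size (no k≰6) = <-irrefl refl (begin-strict
      3 * disjointPairs                   ≤⟨ *-monoʳ-≤ 3 disjointPairs≤accepted+errors ⟩
      3 * (acceptedPairs + errors)        ≡⟨ *-distribˡ-+ 3 acceptedPairs errors ⟩
      3 * acceptedPairs + 3 * errors      <⟨ +-mono-≤-< (Corruption.three-accepted≤two-disjoint (k ℕ./ 24) (l ℕ./ 24)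
                                                          (24*[m/24]≤m k) (24*[m/24]≤m l) (≰⇒> k≰6) bounded) 3errors<disjoint ⟩
      2 * disjointPairs + disjointPairs   ≡⟨ 2n+n≡3n disjointPairs ⟩
      3 * disjointPairs                   ∎)
      where
      open ≤-Reasoning
      2n+n≡3n : ∀ n → 2 * n + n ≡ 3 * n
      2n+n≡3n = solve-∀

  CostlyRun : (Subset d → Subset d → ℕ) → ℕ → Set
  CostlyRun bits n = ∃ λ x → ∃ λ y → ∣ x ∣ ≡ k × ∣ y ∣ ≡ l × (+ 1 ℚ./ 24) ℚ.* fromℕ n ℚ.≤ fromℕ (bits x y)

  some-run-is-costly : .{{_ : NonZero d}} (ε q : ℚ) → 0ℚ ℚ.< ε → (+ 3 ℚ./ 1) ℚ.* ε ℚ.* q ℚ.< 1ℚ →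
    (∀ N → expPartial (+ (3 * k * l) ℚ./ d) N ℚ.≤ q) → HasError≤ π k l ε → TypeII π k l →
    CostlyRun (aliceBits π) k ⊎ CostlyRun (bobBits π) l
  some-run-is-costly ε q 0<ε 3εq<1 expPartial≤q hasError typeII =
    [ inj₁ ∘ sized {aliceBits π} , (λ cheapA →
    [ inj₂ ∘ sized {bobBits π} , (λ cheapB → ⊥-elim (impossible cheapA cheapB)) ]′ (search-pairs X Y (λ x y → l ≤? 24 * bobBits π x y))) ]′
      (search-pairs X Y (λ x y → k ≤? 24 * aliceBits π x y))
    where
    sized : ∀ {bits : Subset d → Subset d → ℕ} {n} → (∃ λ x → ∃ λ y → x ∈ X × y ∈ Y × n ≤ 24 * bits x y) → CostlyRun bits n
    sized {bits} {n} (x , y , x∈X , y∈Y , costly) =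
      x , y , ∈-subsetsOfSize⁻ x∈X , ∈-subsetsOfSize⁻ y∈Y , k≤[1+c]n⇒k/[1+c]≤n {23} {n} {bits x y} costly
    impossible : (∀ x y → x ∈ X → y ∈ Y → ¬ k ≤ 24 * aliceBits π x y) → (∀ x y → x ∈ X → y ∈ Y → ¬ l ≤ 24 * bobBits π x y) → ⊥
    impossible cheapA cheapB = cheap-protocol-impossible ε q 0<ε 3εq<1 expPartial≤q hasError typeII
      (λ x y x∈X y∈Y → ≰⇒> (cheapA x y x∈X y∈Y)) (λ x y x∈X y∈Y → ≰⇒> (cheapB x y x∈X y∈Y))

open import Data.Integer using (+_)
open import Data.Rational using (ℚ; _*_; _/_; _≤_; _<_; 0ℚ; ½)
import Data.Rational.Properties as ℚ

theoremA5 : Σ ℚ λ a → Σ ℚ λ b → (0ℚ < a) × (0ℚ < b) ×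
  ((d : ℕ) → .{{_ : NonZero d}} → (ε : ℚ) → 0ℚ < ε → ε < ½ →
   (k l : ℕ) → k ℕ.≤ l → 3 ℕ.* l ℕ.< d →
   ExpLtInv3ε (+ (3 ℕ.* k ℕ.* l) / d) ε →
   (π : Protocol (Subset d) (Subset d)) →
   HasError≤ π k l ε → TypeII π k l →
   (Σ (Subset d) λ x → Σ (Subset d) λ y → (∣ x ∣ ≡ k) × (∣ y ∣ ≡ l) ×
      (a * (+ k / 1) ≤ (+ aliceBits π x y / 1)))
   ⊎
   (Σ (Subset d) λ x → Σ (Subset d) λ y → (∣ x ∣ ≡ k) × (∣ y ∣ ≡ l) ×
      (b * (+ l / 1) ≤ (+ bobBits π x y / 1))))
theoremA5 = + 1 / 24 , + 1 / 24 , 0<1/24 , 0<1/24 ,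
  λ d ε 0<ε _ k l k≤l 3l<d (q , 3εq<1 , expPartial≤q) π hasError typeII →
    Disjointness.some-run-is-costly k l π k≤l 3l<d ε q 0<ε 3εq<1 expPartial≤q hasError typeII
  where
  0<1/24 : 0ℚ < + 1 / 24
  0<1/24 = ℚ.positive⁻¹ _ {{ℚ.normalize-pos 1 24}}
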